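{- \[ {\bf B}_1^k = \sum_{i=0}^n (pi)^k {\bf e}_i, \quad k=0, 1,\ldots, \] where ${\bf e}_i =\frac{1}{i!} \sum_{a=i}^{n}\frac{(-1)^{a-i}}{p^a(a-i)!}{\bf B}_a$ for $i=0,1,\ldots,n$.
   Context: $G_{n,p}=C_p\wr\mathfrak S_n$ is the colored permutation group (pairs $(s,\sigma)$, $s\in C_p^n$, $\sigma\in\mathfrak S_n$, product $(t,\tau)(s,\sigma)=(\sigma t+s,\tau\sigma)$, $\sigma t=(t_{\sigma(1)},\ldots,t_{\sigma(n)})$), whose elements are regarded as words $(s_1,\sigma(1))\cdots(s_n,\sigma(n))$ over $C_p\times[n]$. For words $u,v$, $u\sqcup\!\sqcup v$ is the shuffle product (formal sum of all interleavings). Let $W_{k,n}=(0,k+1)(0,k+2)\cdots(0,n)$ and define in ${\mathbb Q}G_{n,p}$: ${\mathbf B}_0=id$, ${\mathbf B}_k=\sum_{\alpha\in G_{k,p}}\alpha\sqcup\!\sqcup W_{k,n}$ for $1\le k\le n-1$, ${\mathbf B}_n=\sum_{\alpha\in G_{n,p}}\alpha$. -}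

module Defs where

open import Data.Nat using (ℕ; zero; suc; _+_; _*_; _∸_; _^_; _≤_; _<?_; NonZero; _!)
open import Data.Nat.Properties using (+-suc; m+[n∸m]≡n; _!≢0; m*n≢0; m^n≢0; <⇒≤)
open import Data.Nat.DivMod using (_mod_)
open import Data.Fin as Fin using (Fin; toℕ; _↑ˡ_; _↑ʳ_)
open import Data.Fin.Properties using () renaming (_≟_ to _≟ᶠ_)
open import Data.Vec as Vec using (Vec; []; _∷_; lookup; tabulate; toList)
import Data.Vec.Properties as VecP
open import Data.Product using (_×_; _,_; proj₁; proj₂)
import Data.Product.Properties as ProdP
open import Data.List as List using (List; []; _∷_; [_]; _++_; concatMap; filter; cartesianProduct; allFin; upTo)
import Data.List.Relation.Unary.Unique.DecPropositional as UniqueDec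
open import Data.Integer as ℤ using (ℤ; -1ℤ)
open import Data.Rational as ℚ using (ℚ; 0ℚ; 1ℚ)
open import Relation.Nullary using (does; yes; no)
open import Relation.Binary.PropositionalEquality using (_≡_; subst; sym)
open import Data.Bool using (if_then_else_)

-- Colored permutation group G_{n,p} = C_p ≀ S_n, elements as words.
-- A letter is (colour, position) ∈ C_p × [n]; C_p = Fin p with
-- addition mod p; [n] = Fin n (0-based: index j stands for j+1).

Letter : (p n : ℕ) → Set
Letter p n = Fin p × Fin n

-- words of length n over C_p × [n]; the element (s , σ) is the word
-- (s_1 , σ(1)) ⋯ (s_n , σ(n)).
Word : (p n : ℕ) → Set
Word p n = Vec (Letter p n) n

_⊕_ : {p : ℕ} .{{_ : NonZero p}} → Fin p → Fin p → Fin p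
_⊕_ {p} a b = (toℕ a + toℕ b) mod p

𝟎 : {p : ℕ} .{{_ : NonZero p}} → Fin p
𝟎 {p} = 0 mod p

-- product (t,τ)(s,σ) = (σt + s, τσ), with (σt)_i = t_{σ(i)}
_·_ : {p n : ℕ} .{{_ : NonZero p}} → Word p n → Word p n → Word p n
u · w = Vec.map (λ l → let (c , j) = l ; (c' , k) = lookup u j in (c' ⊕ c , k)) w

idW : {p n : ℕ} .{{_ : NonZero p}} → Word p n
idW = tabulate (λ i → (𝟎 , i))

allVec : {A : Set} → List A → (k : ℕ) → List (Vec A k)
allVec xs zero = [ [] ]
allVec xs (suc k) = concatMap (λ x → List.map (x ∷_) (allVec xs k)) xs

elems : (p k : ℕ) → List (Word p k)
elems p k = filter (λ w → UniqueDec.unique? (_≟ᶠ_ {k}) (toList (Vec.map proj₂ w)))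
                   (allVec (cartesianProduct (allFin p) (allFin k)) k)

-- Group algebra ℚ G_{n,p}: finite formal ℚ-linear combinations of
-- words, compared by coefficients.

QG : (p n : ℕ) → Set
QG p n = List (ℚ × Word p n)

_≟ʷ_ : {p n : ℕ} (u w : Word p n) → _
_≟ʷ_ = VecP.≡-dec (ProdP.≡-dec _≟ᶠ_ _≟ᶠ_)

coeff : {p n : ℕ} → QG p n → Word p n → ℚ
coeff [] w = 0ℚ
coeff ((r , u) ∷ x) w = if does (u ≟ʷ w) then r ℚ.+ coeff x w else coeff x w

_≈ᴬ_ : {p n : ℕ} → QG p n → QG p n → Set
x ≈ᴬ y = ∀ w → coeff x w ≡ coeff y w

_•_ : {p n : ℕ} → ℚ → QG p n → QG p n
q • x = List.map (λ e → (q ℚ.* proj₁ e , proj₂ e)) x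

_*ᴬ_ : {p n : ℕ} .{{_ : NonZero p}} → QG p n → QG p n → QG p n
x *ᴬ y = concatMap (λ e → List.map (λ f → (proj₁ e ℚ.* proj₁ f , proj₂ e · proj₂ f)) y) x

oneᴬ : {p n : ℕ} .{{_ : NonZero p}} → QG p n
oneᴬ = [ (1ℚ , idW) ]

_^ᴬ_ : {p n : ℕ} .{{_ : NonZero p}} → QG p n → ℕ → QG p n
x ^ᴬ zero = oneᴬ
x ^ᴬ suc k = x *ᴬ (x ^ᴬ k)

shuffle : {A : Set} {m l : ℕ} → Vec A m → Vec A l → List (Vec A (m + l))
shuffle [] ys = [ ys ]
shuffle (x ∷ xs) [] = List.map (x ∷_) (shuffle xs [])
shuffle {m = suc m} {l = suc l} (x ∷ xs) (y ∷ ys) =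
  List.map (x ∷_) (shuffle xs (y ∷ ys))
  ++ List.map (λ v → Vec.cast (sym (+-suc (suc m) l)) (y ∷ v)) (shuffle (x ∷ xs) ys)

-- Σ_{α ∈ G_{k,p}} α ⧢ W_{k,k+m}, in ℚ G_{k+m,p};
-- W_{k,k+m} = (0,k+1)(0,k+2)⋯(0,k+m), letters of α viewed in [k+m].
Bsh : (p k m : ℕ) .{{_ : NonZero p}} → QG p (k + m)
Bsh p k m = concatMap (λ α → List.map (λ v → (1ℚ , v))
                                      (shuffle (Vec.map (λ l → (proj₁ l , proj₂ l ↑ˡ m)) α) W))
                      (elems p k)
  where
  W : Vec (Letter p (k + m)) m
  W = tabulate (λ i → (𝟎 , k ↑ʳ i))

-- B_a in ℚ G_{n,p}:  B_0 = id, B_a (1 ≤ a ≤ n-1) via shuffles,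
-- B_n = Σ_{α ∈ G_{n,p}} α.  (Indices a > n are never used; they
-- are sent to B_n.)
B : (p n : ℕ) .{{_ : NonZero p}} → ℕ → QG p n
B p n zero = oneᴬ
B p n (suc a) with suc a <? n
... | yes a<n = subst (QG p) (m+[n∸m]≡n (<⇒≤ a<n)) (Bsh p (suc a) (n ∸ suc a))
... | no _ = List.map (λ α → (1ℚ , α)) (elems p n)

coefE : (p i a : ℕ) .{{_ : NonZero p}} → ℚ
coefE p i a = ℚ._/_ (-1ℤ ℤ.^ (a ∸ i)) (i ! * (p ^ a * (a ∸ i) !))
  {{m*n≢0 (i !) (p ^ a * (a ∸ i) !) {{i !≢0}} {{m*n≢0 (p ^ a) ((a ∸ i) !) {{m^n≢0 p a}} {{(a ∸ i) !≢0}}}}}}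

e : (p n : ℕ) .{{_ : NonZero p}} → ℕ → QG p n
e p n i = concatMap (λ j → coefE p i (i + j) • B p n (i + j)) (upTo (suc (n ∸ i)))

rhs : (p n : ℕ) .{{_ : NonZero p}} → ℕ → QG p n
rhs p n k = concatMap (λ i → ((ℤ.+ ((p * i) ^ k)) ℚ./ 1) • e p n i) (upTo (suc n))

-- Write β a w for the coefficient of B_a at the word w: with 0-based positions, it is 1 exactly when w is a
-- coloured permutation whose letters of position ≥ a are (0 , a) ⋯ (0 , n-1) in this order. The summands of B₁
-- are the identity with one letter (c , 0) inserted at some index t, and counting the ways to write w as such a
-- summand times a word u gives B₁ B_a = p a B_a + B_{a+1}, with B_{n+1} = 0: insertions at t < a leave the tail
-- of u intact (p a choices), while for t ≥ a the tail of u must be that of w with the unique letter of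
-- position 0 moved into it. Hence the coefficients of B₁^k obey a linear recursion in k. The right-hand side
-- obeys the same one, since telescoping the coefficients of e_i gives B₁ e_i = p i e_i, and it agrees for k = 0,
-- where Σ_i e_i = B₀ reduces to the alternating binomial identity Σ_{i ≤ a} (-1)^{a-i} / (i! (a-i)!) = 0 for a > 0.

module Submission where

open import Defs
open import Data.Nat using (ℕ; zero; suc; _≤_; NonZero)
open import Data.Bool using (Bool)
open import Relation.Binary.Definitions using (DecidableEquality)
open import Relation.Binary.PropositionalEquality using (trans; sym)
open import Relation.Nullary.Decidable using (does-⇔)
open import Function.Bundles using (_⇔_; mk⇔; module Equivalence)

module Sums where

  open import Data.Nat as ℕ using (ℕ; zero; suc; _<_; s≤s; z≤n)
  import Data.Nat.Properties as ℕP
  open import Data.Rational using (ℚ; 0ℚ; 1ℚ; _+_; _*_)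
  open import Data.Rational.Properties
  open import Data.Rational.Solver using (module +-*-Solver)
  open import Data.List using (List; []; _∷_; _++_; map; concatMap; filter; applyUpTo; upTo)
  open import Data.Bool using (Bool; true; false; _∧_)
  open import Relation.Nullary using (does; Dec; yes; no; ¬_)
  open import Relation.Unary using (Decidable)
  open import Relation.Binary.PropositionalEquality
  open import Function using (_∘_)
  open import Data.Empty using (⊥-elim)
  open +-*-Solver using (solve; _:+_; _:=_)

  𝟙⟨_⟩ : Bool → ℚ
  𝟙⟨ true ⟩ = 1ℚ
  𝟙⟨ false ⟩ = 0ℚ

  𝟙-∧ : ∀ x y → 𝟙⟨ x ∧ y ⟩ ≡ 𝟙⟨ x ⟩ * 𝟙⟨ y ⟩
  𝟙-∧ true y = sym (*-identityˡ _)
  𝟙-∧ false y = sym (*-zeroˡ 𝟙⟨ y ⟩)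

  𝟙-no : {P : Set} (d : Dec P) → ¬ P → 𝟙⟨ does d ⟩ ≡ 0ℚ
  𝟙-no (yes p) ¬p = ⊥-elim (¬p p)
  𝟙-no (no _) _ = refl

  private
    interchange : ∀ a b c d → (a + b) + (c + d) ≡ (a + c) + (b + d)
    interchange = solve 4 (λ a b c d → (a :+ b) :+ (c :+ d) := (a :+ c) :+ (b :+ d)) refl

  ΣL : {A : Set} → List A → (A → ℚ) → ℚ
  ΣL [] f = 0ℚ
  ΣL (x ∷ xs) f = f x + ΣL xs f

  module _ {A : Set} where
    ΣL-cong : (xs : List A) {f g : A → ℚ} → (∀ x → f x ≡ g x) → ΣL xs f ≡ ΣL xs g
    ΣL-cong [] eq = refl
    ΣL-cong (x ∷ xs) eq = cong₂ _+_ (eq x) (ΣL-cong xs eq)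

    ΣL-++ : (xs ys : List A) (f : A → ℚ) → ΣL (xs ++ ys) f ≡ ΣL xs f + ΣL ys f
    ΣL-++ [] ys f = sym (+-identityˡ _)
    ΣL-++ (x ∷ xs) ys f = trans (cong (f x +_) (ΣL-++ xs ys f)) (sym (+-assoc (f x) _ _))

    ΣL-+ : (xs : List A) (f g : A → ℚ) → ΣL xs (λ x → f x + g x) ≡ ΣL xs f + ΣL xs g
    ΣL-+ [] f g = refl
    ΣL-+ (x ∷ xs) f g = trans (cong ((f x + g x) +_) (ΣL-+ xs f g)) (interchange (f x) (g x) _ _)

    ΣL-*ˡ : (xs : List A) (c : ℚ) (f : A → ℚ) → ΣL xs (λ x → c * f x) ≡ c * ΣL xs f
    ΣL-*ˡ [] c f = sym (*-zeroʳ c)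
    ΣL-*ˡ (x ∷ xs) c f = trans (cong (c * f x +_) (ΣL-*ˡ xs c f)) (sym (*-distribˡ-+ c (f x) _))

    ΣL-zero : (xs : List A) → ΣL xs (λ _ → 0ℚ) ≡ 0ℚ
    ΣL-zero [] = refl
    ΣL-zero (x ∷ xs) = trans (+-identityˡ _) (ΣL-zero xs)

    ΣL-filter : {P : A → Set} (P? : Decidable P) (xs : List A) (f : A → ℚ) →
                ΣL (filter P? xs) f ≡ ΣL xs (λ x → 𝟙⟨ does (P? x) ⟩ * f x)
    ΣL-filter P? [] f = refl
    ΣL-filter P? (x ∷ xs) f with does (P? x)
    ... | true = cong₂ _+_ (sym (*-identityˡ (f x))) (ΣL-filter P? xs f)
    ... | false = trans (ΣL-filter P? xs f) (sym (trans (cong (_+ _) (*-zeroˡ (f x))) (+-identityˡ _)))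

  module _ {A B : Set} where
    ΣL-map : (g : A → B) (xs : List A) (f : B → ℚ) → ΣL (map g xs) f ≡ ΣL xs (f ∘ g)
    ΣL-map g [] f = refl
    ΣL-map g (x ∷ xs) f = cong (f (g x) +_) (ΣL-map g xs f)

    ΣL-concatMap : (g : A → List B) (xs : List A) (f : B → ℚ) →
                   ΣL (concatMap g xs) f ≡ ΣL xs (λ x → ΣL (g x) f)
    ΣL-concatMap g [] f = refl
    ΣL-concatMap g (x ∷ xs) f = trans (ΣL-++ (g x) (concatMap g xs) f) (cong (ΣL (g x) f +_) (ΣL-concatMap g xs f))

    ΣL-swap : (xs : List A) (ys : List B) (f : A → B → ℚ) →
              ΣL xs (λ x → ΣL ys (f x)) ≡ ΣL ys (λ y → ΣL xs (λ x → f x y))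
    ΣL-swap [] ys f = sym (ΣL-zero ys)
    ΣL-swap (x ∷ xs) ys f = trans (cong (ΣL ys (f x) +_) (ΣL-swap xs ys f)) (sym (ΣL-+ ys (f x) _))

  Σ< : ℕ → (ℕ → ℚ) → ℚ
  Σ< zero f = 0ℚ
  Σ< (suc n) f = f 0 + Σ< n (f ∘ suc)

  ΣL-applyUpTo : (g : ℕ → ℕ) (n : ℕ) (f : ℕ → ℚ) → ΣL (applyUpTo g n) f ≡ Σ< n (f ∘ g)
  ΣL-applyUpTo g zero f = refl
  ΣL-applyUpTo g (suc n) f = cong (f (g 0) +_) (ΣL-applyUpTo (g ∘ suc) n f)

  ΣL-upTo : (n : ℕ) (f : ℕ → ℚ) → ΣL (upTo n) f ≡ Σ< n f
  ΣL-upTo = ΣL-applyUpTo (λ i → i)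

  Σ<-cong : (n : ℕ) {f g : ℕ → ℚ} → (∀ i → i < n → f i ≡ g i) → Σ< n f ≡ Σ< n g
  Σ<-cong zero eq = refl
  Σ<-cong (suc n) eq = cong₂ _+_ (eq 0 (s≤s z≤n)) (Σ<-cong n (λ i i<n → eq (suc i) (s≤s i<n)))

  Σ<-zero : ∀ n → Σ< n (λ _ → 0ℚ) ≡ 0ℚ
  Σ<-zero zero = refl
  Σ<-zero (suc n) = trans (+-identityˡ _) (Σ<-zero n)

  Σ<-+ : (n : ℕ) (f g : ℕ → ℚ) → Σ< n (λ i → f i + g i) ≡ Σ< n f + Σ< n g
  Σ<-+ zero f g = sym (+-identityˡ _)
  Σ<-+ (suc n) f g = trans (cong ((f 0 + g 0) +_) (Σ<-+ n _ _)) (interchange (f 0) (g 0) _ _)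

  Σ<-*ˡ : (n : ℕ) (c : ℚ) (f : ℕ → ℚ) → Σ< n (λ i → c * f i) ≡ c * Σ< n f
  Σ<-*ˡ zero c f = sym (*-zeroʳ c)
  Σ<-*ˡ (suc n) c f = trans (cong (c * f 0 +_) (Σ<-*ˡ n c _)) (sym (*-distribˡ-+ c (f 0) _))

  Σ<-*ʳ : (n : ℕ) (f : ℕ → ℚ) (c : ℚ) → Σ< n (λ i → f i * c) ≡ Σ< n f * c
  Σ<-*ʳ n f c = trans (Σ<-cong n (λ i _ → *-comm (f i) c)) (trans (Σ<-*ˡ n c f) (*-comm c (Σ< n f)))

  Σ<-split : (a b : ℕ) (f : ℕ → ℚ) → Σ< (a ℕ.+ b) f ≡ Σ< a f + Σ< b (λ s → f (a ℕ.+ s))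
  Σ<-split zero b f = sym (+-identityˡ _)
  Σ<-split (suc a) b f = trans (cong (f 0 +_) (Σ<-split a b (f ∘ suc))) (sym (+-assoc (f 0) _ _))

  Σ<-last : (n : ℕ) (f : ℕ → ℚ) → Σ< (suc n) f ≡ Σ< n f + f n
  Σ<-last n f = begin
    Σ< (suc n) f                              ≡⟨ cong (λ k → Σ< k f) (ℕP.+-comm 1 n) ⟩
    Σ< (n ℕ.+ 1) f                            ≡⟨ Σ<-split n 1 f ⟩
    Σ< n f + (f (n ℕ.+ 0) + 0ℚ)               ≡⟨ cong (Σ< n f +_) (trans (+-identityʳ _) (cong f (ℕP.+-identityʳ n))) ⟩
    Σ< n f + f n                              ∎
    where open ≡-Reasoning

  Σ<-swap : ∀ m n (f : ℕ → ℕ → ℚ) → Σ< m (λ i → Σ< n (f i)) ≡ Σ< n (λ j → Σ< m (λ i → f i j))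
  Σ<-swap zero n f = sym (Σ<-zero n)
  Σ<-swap (suc m) n f = trans (cong (Σ< n (f 0) +_) (Σ<-swap m n (f ∘ suc))) (sym (Σ<-+ n (f 0) _))

  Σ<²-Σ<-*ˡ : ∀ l m n (a : ℕ → ℚ) (g : ℕ → ℕ → ℕ → ℚ) →
    Σ< l (λ c → Σ< m (λ t → Σ< n (λ i → a i * g c t i))) ≡ Σ< n (λ i → a i * Σ< l (λ c → Σ< m (λ t → g c t i)))
  Σ<²-Σ<-*ˡ l m n a g = begin
      Σ< l (λ c → Σ< m (λ t → Σ< n (λ i → a i * g c t i)))
    ≡⟨ Σ<-cong l (λ c _ → Σ<-swap m n (λ t i → a i * g c t i)) ⟩
      Σ< l (λ c → Σ< n (λ i → Σ< m (λ t → a i * g c t i)))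
    ≡⟨ Σ<-swap l n (λ c i → Σ< m (λ t → a i * g c t i)) ⟩
      Σ< n (λ i → Σ< l (λ c → Σ< m (λ t → a i * g c t i)))
    ≡⟨ Σ<-cong n (λ i _ → trans (Σ<-cong l (λ c _ → Σ<-*ˡ m (a i) (λ t → g c t i))) (Σ<-*ˡ l (a i) (λ c → Σ< m (λ t → g c t i)))) ⟩
      Σ< n (λ i → a i * Σ< l (λ c → Σ< m (λ t → g c t i))) ∎
    where open ≡-Reasoning

  ΣL-Σ< : {A : Set} (xs : List A) (n : ℕ) (f : A → ℕ → ℚ) → ΣL xs (λ x → Σ< n (f x)) ≡ Σ< n (λ i → ΣL xs (λ x → f x i))
  ΣL-Σ< xs n f = trans (ΣL-cong xs (λ x → sym (ΣL-upTo n (f x)))) (trans (ΣL-swap xs (upTo n) f) (ΣL-upTo n _))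

module NatEmbedding where

  open import Data.Nat as ℕ using (ℕ; zero; suc)
  open import Data.Integer as ℤ using (ℤ)
  import Data.Integer.Properties as ℤP
  import Data.Nat.Properties as ℕP
  open import Data.Rational as ℚ using (ℚ; 0ℚ; 1ℚ; _+_; _*_; -_; fromℚᵘ)
  open import Data.Rational.Properties
  open import Data.Rational.Unnormalised as ℚᵘ using (mkℚᵘ; *≡*)
  import Data.Rational.Unnormalised.Properties as ℚᵘP
  open import Relation.Binary.PropositionalEquality
  open Sums

  fromℚᵘ-+ : ∀ p q → fromℚᵘ (p ℚᵘ.+ q) ≡ fromℚᵘ p + fromℚᵘ q
  fromℚᵘ-+ p q = toℚᵘ-injective (ℚᵘP.≃-trans (toℚᵘ-fromℚᵘ (p ℚᵘ.+ q))
    (ℚᵘP.≃-sym (ℚᵘP.≃-trans (toℚᵘ-homo-+ (fromℚᵘ p) (fromℚᵘ q)) (ℚᵘP.+-cong (toℚᵘ-fromℚᵘ p) (toℚᵘ-fromℚᵘ q)))))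

  fromℚᵘ-* : ∀ p q → fromℚᵘ (p ℚᵘ.* q) ≡ fromℚᵘ p * fromℚᵘ q
  fromℚᵘ-* p q = toℚᵘ-injective (ℚᵘP.≃-trans (toℚᵘ-fromℚᵘ (p ℚᵘ.* q))
    (ℚᵘP.≃-sym (ℚᵘP.≃-trans (toℚᵘ-homo-* (fromℚᵘ p) (fromℚᵘ q)) (ℚᵘP.*-cong (toℚᵘ-fromℚᵘ p) (toℚᵘ-fromℚᵘ q)))))

  fromℚᵘ-neg : ∀ p → fromℚᵘ (ℚᵘ.- p) ≡ - fromℚᵘ p
  fromℚᵘ-neg p = toℚᵘ-injective (ℚᵘP.≃-trans (toℚᵘ-fromℚᵘ (ℚᵘ.- p))
    (ℚᵘP.≃-sym (ℚᵘP.≃-trans (toℚᵘ-homo‿- (fromℚᵘ p)) (ℚᵘP.-‿cong (toℚᵘ-fromℚᵘ p)))))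

  -- The form in which rhs casts naturals; ι n is definitionally fromℚᵘ (mkℚᵘ (+ n) 0), which the proofs below use.
  ι : ℕ → ℚ
  ι n = ℤ.+ n ℚ./ 1

  ι-+ : ∀ m n → ι (m ℕ.+ n) ≡ ι m + ι n
  ι-+ m n = trans (fromℚᵘ-cong {mkℚᵘ (ℤ.+ (m ℕ.+ n)) 0} {mkℚᵘ (ℤ.+ m) 0 ℚᵘ.+ mkℚᵘ (ℤ.+ n) 0} (*≡* eq)) (fromℚᵘ-+ (mkℚᵘ (ℤ.+ m) 0) (mkℚᵘ (ℤ.+ n) 0))
    where
    eq : ℤ.+ (m ℕ.+ n) ℤ.* ℤ.+ 1 ≡ (ℤ.+ m ℤ.* ℤ.+ 1 ℤ.+ ℤ.+ n ℤ.* ℤ.+ 1) ℤ.* ℤ.+ 1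
    eq rewrite ℤP.*-identityʳ (ℤ.+ m) | ℤP.*-identityʳ (ℤ.+ n) = cong (ℤ._* ℤ.+ 1) (ℤP.pos-+ m n)

  ι-* : ∀ m n → ι (m ℕ.* n) ≡ ι m * ι n
  ι-* m n = trans (fromℚᵘ-cong {mkℚᵘ (ℤ.+ (m ℕ.* n)) 0} {mkℚᵘ (ℤ.+ m) 0 ℚᵘ.* mkℚᵘ (ℤ.+ n) 0} (*≡* (cong (ℤ._* ℤ.+ 1) (ℤP.pos-* m n)))) (fromℚᵘ-* (mkℚᵘ (ℤ.+ m) 0) (mkℚᵘ (ℤ.+ n) 0))

  ι-suc≢0 : ∀ m → ι (suc m) ≢ 0ℚ
  ι-suc≢0 m e with fromℚᵘ-injective {mkℚᵘ (ℤ.+ suc m) 0} {mkℚᵘ (ℤ.+ 0) 0} e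
  ... | *≡* ()

  ι-suc*≡0⇒≡0 : ∀ m (S : ℚ) → ι (suc m) * S ≡ 0ℚ → S ≡ 0ℚ
  ι-suc*≡0⇒≡0 m S e = begin
      S                        ≡⟨ sym (*-identityˡ S) ⟩
      1ℚ * S                   ≡⟨ cong (_* S) (sym (*-inverseˡ (ι (suc m)))) ⟩
      ι⁻¹ * ι (suc m) * S      ≡⟨ *-assoc ι⁻¹ (ι (suc m)) S ⟩
      ι⁻¹ * (ι (suc m) * S)    ≡⟨ cong (ι⁻¹ *_) e ⟩
      ι⁻¹ * 0ℚ                 ≡⟨ *-zeroʳ ι⁻¹ ⟩
      0ℚ                       ∎
    where
    open ≡-Reasoning
    instance
      nonZero : ℚ.NonZero (ι (suc m))
      nonZero = ℚ.≢-nonZero (ι-suc≢0 m)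
    ι⁻¹ : ℚ
    ι⁻¹ = ℚ.1/ ι (suc m)

  Σ<-const : ∀ n (x : ℚ) → Σ< n (λ _ → x) ≡ ι n * x
  Σ<-const zero x = sym (*-zeroˡ x)
  Σ<-const (suc n) x = trans (cong (x +_) (Σ<-const n x))
    (sym (trans (cong (_* x) (ι-+ 1 n)) (trans (*-distribʳ-+ x (ι 1) (ι n)) (cong (_+ ι n * x) (*-identityˡ x)))))

  /-cross : ∀ (x y : ℤ) (d e : ℕ) .{{_ : ℕ.NonZero d}} .{{_ : ℕ.NonZero e}} →
    x ℤ.* ℤ.+ e ≡ y ℤ.* ℤ.+ d → x ℚ./ d ≡ y ℚ./ e
  /-cross x y (suc d) (suc e) eq = fromℚᵘ-cong {mkℚᵘ x d} {mkℚᵘ y e} (*≡* eq)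

  /-*-/ : ∀ (x y : ℤ) (d e : ℕ) .{{_ : ℕ.NonZero d}} .{{_ : ℕ.NonZero e}} .{{_ : ℕ.NonZero (d ℕ.* e)}} →
    (x ℚ./ d) * (y ℚ./ e) ≡ (x ℤ.* y) ℚ./ (d ℕ.* e)
  /-*-/ x y (suc d) (suc e) = sym (fromℚᵘ-* (mkℚᵘ x d) (mkℚᵘ y e))

  /-denominator : ∀ (x : ℤ) {d d′ : ℕ} .{{_ : ℕ.NonZero d}} .{{_ : ℕ.NonZero d′}} → d ≡ d′ → x ℚ./ d ≡ x ℚ./ d′
  /-denominator x refl = refl

  /-*-ι : ∀ (x : ℤ) (m d : ℕ) .{{_ : ℕ.NonZero d}} .{{_ : ℕ.NonZero (m ℕ.* d)}} → (x ℚ./ (m ℕ.* d)) * ι m ≡ x ℚ./ d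
  /-*-ι x m d = trans (/-*-/ x (ℤ.+ m) (m ℕ.* d) 1 {{_}} {{_}} {{ℕP.m*n≢0 (m ℕ.* d) 1}}) (/-cross (x ℤ.* ℤ.+ m) x (m ℕ.* d ℕ.* 1) d
    {{ℕP.m*n≢0 (m ℕ.* d) 1}} (begin
      x ℤ.* ℤ.+ m ℤ.* ℤ.+ d      ≡⟨ ℤP.*-assoc x (ℤ.+ m) (ℤ.+ d) ⟩
      x ℤ.* (ℤ.+ m ℤ.* ℤ.+ d)    ≡⟨ cong (x ℤ.*_) (sym (ℤP.pos-* m d)) ⟩
      x ℤ.* ℤ.+ (m ℕ.* d)        ≡⟨ cong (λ k → x ℤ.* ℤ.+ k) (sym (ℕP.*-identityʳ (m ℕ.* d))) ⟩
      x ℤ.* ℤ.+ (m ℕ.* d ℕ.* 1)  ∎))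
    where open ≡-Reasoning

  -‿/ : ∀ (x : ℤ) (d : ℕ) .{{_ : ℕ.NonZero d}} → - (x ℚ./ d) ≡ (ℤ.- x) ℚ./ d
  -‿/ x (suc d) = sym (fromℚᵘ-neg (mkℚᵘ x d))

module Coefficients where

  open Sums
  open import Data.Nat using (ℕ; NonZero)
  open import Data.Rational using (ℚ; 1ℚ; _+_; _*_)
  open import Data.Rational.Properties
  open import Data.List using (List; []; _∷_; _++_; map; concatMap)
  open import Data.Product using (_,_; proj₁; proj₂)
  open import Data.Bool using (true; false)
  open import Relation.Nullary using (does)
  open import Relation.Binary.PropositionalEquality

  module _ {p n : ℕ} where
    coeff-++ : (x y : QG p n) (w : Word p n) → coeff (x ++ y) w ≡ coeff x w + coeff y w
    coeff-++ [] y w = sym (+-identityˡ _)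
    coeff-++ ((r , u) ∷ x) y w with does (u ≟ʷ w)
    ... | true = trans (cong (r +_) (coeff-++ x y w)) (sym (+-assoc r _ _))
    ... | false = coeff-++ x y w

    coeff-• : (q : ℚ) (x : QG p n) (w : Word p n) → coeff (q • x) w ≡ q * coeff x w
    coeff-• q [] w = sym (*-zeroʳ q)
    coeff-• q ((r , u) ∷ x) w with does (u ≟ʷ w)
    ... | true = trans (cong (q * r +_) (coeff-• q x w)) (sym (*-distribˡ-+ q r _))
    ... | false = coeff-• q x w

    coeff≡ΣL : (x : QG p n) (w : Word p n) → coeff x w ≡ ΣL x (λ e → proj₁ e * 𝟙⟨ does (proj₂ e ≟ʷ w) ⟩)
    coeff≡ΣL [] w = refl
    coeff≡ΣL ((r , u) ∷ x) w with does (u ≟ʷ w)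
    ... | true = cong₂ _+_ (sym (*-identityʳ r)) (coeff≡ΣL x w)
    ... | false = trans (coeff≡ΣL x w) (sym (trans (cong (_+ _) (*-zeroʳ r)) (+-identityˡ _)))

  module _ {A : Set} {p n : ℕ} where
    coeff-concatMap : (f : A → QG p n) (xs : List A) (w : Word p n) →
                      coeff (concatMap f xs) w ≡ ΣL xs (λ a → coeff (f a) w)
    coeff-concatMap f [] w = refl
    coeff-concatMap f (a ∷ xs) w = trans (coeff-++ (f a) (concatMap f xs) w) (cong (coeff (f a) w +_) (coeff-concatMap f xs w))

    coeff-map-unit : (g : A → Word p n) (xs : List A) (w : Word p n) →
                     coeff (map (λ a → (1ℚ , g a)) xs) w ≡ ΣL xs (λ a → 𝟙⟨ does (g a ≟ʷ w) ⟩)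
    coeff-map-unit g xs w = trans (coeff≡ΣL (map (λ a → (1ℚ , g a)) xs) w) (trans (ΣL-map (λ a → (1ℚ , g a)) xs _) (ΣL-cong xs (λ a → *-identityˡ _)))

  module _ {p n : ℕ} .{{_ : NonZero p}} where
    leftMul : Word p n → QG p n → QG p n
    leftMul u y = map (λ f → (proj₁ f , u · proj₂ f)) y

    private
      coeff-scaled-leftMul : (r : ℚ) (u : Word p n) (y : QG p n) (w : Word p n) →
        coeff (map (λ f → (r * proj₁ f , u · proj₂ f)) y) w ≡ r * coeff (leftMul u y) w
      coeff-scaled-leftMul r u [] w = sym (*-zeroʳ r)
      coeff-scaled-leftMul r u ((s , v) ∷ y) w with does ((u · v) ≟ʷ w)
      ... | true = trans (cong (r * s +_) (coeff-scaled-leftMul r u y w)) (sym (*-distribˡ-+ r s _))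
      ... | false = coeff-scaled-leftMul r u y w

    coeff-*ᴬ : (x y : QG p n) (w : Word p n) →
      coeff (x *ᴬ y) w ≡ ΣL x (λ e → proj₁ e * coeff (leftMul (proj₂ e) y) w)
    coeff-*ᴬ x y w = trans (coeff-concatMap _ x w) (ΣL-cong x (λ e → coeff-scaled-leftMul (proj₁ e) (proj₂ e) y w))

module Enumeration where

  open Sums
  open import Data.Bool using (true; false)
  open import Data.Nat using (ℕ; zero; suc)
  open import Data.Fin as Fin using (Fin; zero; suc)
  open import Data.Fin.Properties using (suc-injective) renaming (_≟_ to _≟ᶠ_)
  open import Data.Rational using (ℚ; 0ℚ; _+_; _*_)
  open import Data.Rational.Properties
  open import Data.List as List using (List; []; _∷_; map; concatMap; cartesianProduct; cartesianProductWith; allFin)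
  open import Data.Vec as Vec using ([]; _∷_)
  import Data.Vec.Properties as VecP
  import Data.Product.Properties as ProdP
  open import Data.Product using (_×_; _,_; proj₁; proj₂)
  open import Relation.Nullary using (does)
  open import Relation.Nullary.Decidable using (_×-dec_)
  open import Relation.Binary.Definitions using (DecidableEquality)
  open import Relation.Binary.PropositionalEquality

  -- Each element of A occurs exactly once in xs, phrased as the sifting property of the sum over xs.
  IsEnumeration : {A : Set} → DecidableEquality A → List A → Set
  IsEnumeration {A} _≟_ xs = ∀ (a : A) (G : A → ℚ) → ΣL xs (λ b → 𝟙⟨ does (b ≟ a) ⟩ * G b) ≡ G a

  ΣFin : ∀ n → (Fin n → ℚ) → ℚ
  ΣFin zero f = 0ℚ
  ΣFin (suc n) f = f zero + ΣFin n (λ i → f (suc i))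

  ΣFin-cong : ∀ n {f g : Fin n → ℚ} → (∀ i → f i ≡ g i) → ΣFin n f ≡ ΣFin n g
  ΣFin-cong zero eq = refl
  ΣFin-cong (suc n) eq = cong₂ _+_ (eq zero) (ΣFin-cong n (λ i → eq (suc i)))

  ΣFin-zero : ∀ n → ΣFin n (λ _ → 0ℚ) ≡ 0ℚ
  ΣFin-zero zero = refl
  ΣFin-zero (suc n) = trans (+-identityˡ _) (ΣFin-zero n)

  ΣL-tabulate : {B : Set} (n : ℕ) (h : Fin n → B) (F : B → ℚ) → ΣL (List.tabulate h) F ≡ ΣFin n (λ i → F (h i))
  ΣL-tabulate zero h F = refl
  ΣL-tabulate (suc n) h F = cong (F (h zero) +_) (ΣL-tabulate n (λ i → h (suc i)) F)

  ΣFin-δ : ∀ n (a : Fin n) (G : Fin n → ℚ) → ΣFin n (λ b → 𝟙⟨ does (b ≟ᶠ a) ⟩ * G b) ≡ G a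
  ΣFin-δ (suc n) zero G = trans (cong₂ _+_ (*-identityˡ (G zero))
    (trans (ΣFin-cong n (λ b → *-zeroˡ (G (suc b)))) (ΣFin-zero n))) (+-identityʳ _)
  ΣFin-δ (suc n) (suc a) G = trans (cong₂ _+_ (*-zeroˡ (G zero))
    (trans (ΣFin-cong n (λ b → cong (λ z → 𝟙⟨ z ⟩ * G (suc b)) (does-⇔ (mk⇔ suc-injective (cong suc)) (suc b ≟ᶠ suc a) (b ≟ᶠ a))))
           (ΣFin-δ n a (λ i → G (suc i))))) (+-identityˡ _)

  IsEnumeration-allFin : ∀ n → IsEnumeration _≟ᶠ_ (allFin n)
  IsEnumeration-allFin n a G = trans (ΣL-tabulate n (λ i → i) _) (ΣFin-δ n a G)

  module _ {A B C : Set} (_≟A_ : DecidableEquality A) (_≟B_ : DecidableEquality B) (_≟C_ : DecidableEquality C)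
           (f : A → B → C) (π₁ : C → A) (π₂ : C → B)
           (f-inj : ∀ {a b} c → f a b ≡ c → a ≡ π₁ c × b ≡ π₂ c) (f-π : ∀ c → f (π₁ c) (π₂ c) ≡ c) where

    sift-pairs : (xs : List A) (ys : List B) → IsEnumeration _≟A_ xs → IsEnumeration _≟B_ ys →
      ∀ c (G : C → ℚ) → ΣL xs (λ a → ΣL ys (λ b → 𝟙⟨ does (f a b ≟C c) ⟩ * G (f a b))) ≡ G c
    sift-pairs xs ys Ex Ey c G = begin
        ΣL xs (λ a → ΣL ys (λ b → 𝟙⟨ does (f a b ≟C c) ⟩ * G (f a b)))
      ≡⟨ ΣL-cong xs (λ a → ΣL-cong ys (λ b → trans (cong (_* G (f a b)) (split a b)) (*-assoc 𝟙⟨ does (a ≟A π₁ c) ⟩ _ (G (f a b))))) ⟩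
        ΣL xs (λ a → ΣL ys (λ b → 𝟙⟨ does (a ≟A π₁ c) ⟩ * (𝟙⟨ does (b ≟B π₂ c) ⟩ * G (f a b))))
      ≡⟨ ΣL-cong xs (λ a → trans (ΣL-*ˡ ys 𝟙⟨ does (a ≟A π₁ c) ⟩ (λ b → 𝟙⟨ does (b ≟B π₂ c) ⟩ * G (f a b))) (cong (𝟙⟨ does (a ≟A π₁ c) ⟩ *_) (Ey (π₂ c) (λ b → G (f a b))))) ⟩
        ΣL xs (λ a → 𝟙⟨ does (a ≟A π₁ c) ⟩ * G (f a (π₂ c)))
      ≡⟨ Ex (π₁ c) (λ a → G (f a (π₂ c))) ⟩
        G (f (π₁ c) (π₂ c))
      ≡⟨ cong G (f-π c) ⟩
        G c ∎
      where
      open ≡-Reasoning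
      split : ∀ a b → 𝟙⟨ does (f a b ≟C c) ⟩ ≡ 𝟙⟨ does (a ≟A π₁ c) ⟩ * 𝟙⟨ does (b ≟B π₂ c) ⟩
      split a b = trans (cong 𝟙⟨_⟩ (does-⇔ (mk⇔ (f-inj c) (λ { (refl , refl) → f-π c })) (f a b ≟C c) ((a ≟A π₁ c) ×-dec (b ≟B π₂ c))))
                        (𝟙-∧ (does (a ≟A π₁ c)) _)

  ΣL-cartesianProductWith : {A B C : Set} (f : A → B → C) (xs : List A) (ys : List B) (F : C → ℚ) →
    ΣL (cartesianProductWith f xs ys) F ≡ ΣL xs (λ a → ΣL ys (λ b → F (f a b)))
  ΣL-cartesianProductWith f [] ys F = refl
  ΣL-cartesianProductWith f (x ∷ xs) ys F =
    trans (ΣL-++ (map (f x) ys) _ F) (cong₂ _+_ (ΣL-map (f x) ys F) (ΣL-cartesianProductWith f xs ys F))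

  ΣL-concatMap-map : {A B C : Set} (f : A → B → C) (xs : List A) (ys : List B) (F : C → ℚ) →
    ΣL (concatMap (λ a → map (f a) ys) xs) F ≡ ΣL xs (λ a → ΣL ys (λ b → F (f a b)))
  ΣL-concatMap-map f xs ys F = trans (ΣL-concatMap (λ a → map (f a) ys) xs F) (ΣL-cong xs (λ a → ΣL-map (f a) ys F))

  Letters : (p n : ℕ) → List (Letter p n)
  Letters p n = cartesianProduct (allFin p) (allFin n)

  _≟ˡ_ : {p n : ℕ} → DecidableEquality (Letter p n)
  _≟ˡ_ = ProdP.≡-dec _≟ᶠ_ _≟ᶠ_

  IsEnumeration-Letters : (p n : ℕ) → IsEnumeration _≟ˡ_ (Letters p n)
  IsEnumeration-Letters p n c G = trans (ΣL-cartesianProductWith _,_ (allFin p) (allFin n) _)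
    (sift-pairs _≟ᶠ_ _≟ᶠ_ _≟ˡ_ _,_ proj₁ proj₂ (λ { _ refl → refl , refl }) (λ _ → refl)
       (allFin p) (allFin n) (IsEnumeration-allFin p) (IsEnumeration-allFin n) c G)

  IsEnumeration-allVec : {A : Set} (_≟_ : DecidableEquality A) {xs : List A} → IsEnumeration _≟_ xs →
    ∀ k → IsEnumeration (VecP.≡-dec _≟_) (allVec xs k)
  IsEnumeration-allVec _≟_ E zero [] G = trans (cong (_+ 0ℚ) (*-identityˡ (G []))) (+-identityʳ _)
  IsEnumeration-allVec _≟_ {xs} E (suc k) c G = trans (ΣL-concatMap-map _∷_ xs (allVec xs k) _)
    (sift-pairs _≟_ (VecP.≡-dec _≟_) (VecP.≡-dec _≟_) _∷_ Vec.head Vec.tail (λ { _ refl → refl , refl }) (λ { (x ∷ v) → refl })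
       xs (allVec xs k) E (IsEnumeration-allVec _≟_ E k) c G)

  allWords : (p n : ℕ) → List (Word p n)
  allWords p n = allVec (Letters p n) n

  IsEnumeration-allWords : (p n : ℕ) → IsEnumeration _≟ʷ_ (allWords p n)
  IsEnumeration-allWords p n = IsEnumeration-allVec _≟ˡ_ (IsEnumeration-Letters p n) n

  ΣL-allWords-δ : {p n : ℕ} (u₀ : Word p n) (H : Word p n → ℚ) → ΣL (allWords p n) (λ u → 𝟙⟨ does (u₀ ≟ʷ u) ⟩ * H u) ≡ H u₀
  ΣL-allWords-δ {p} {n} u₀ H =
    trans (ΣL-cong (allWords p n) (λ b → cong (λ z → 𝟙⟨ z ⟩ * H b) (does-⇔ (mk⇔ sym sym) (u₀ ≟ʷ b) (b ≟ʷ u₀)))) (IsEnumeration-allWords p n u₀ H)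

  ΣL-support : {p n : ℕ} (x : QG p n) (H : Word p n → ℚ) →
    ΣL x (λ e → proj₁ e * H (proj₂ e)) ≡ ΣL (allWords p n) (λ u → coeff x u * H u)
  ΣL-support {p} {n} [] H = sym (trans (ΣL-cong (allWords p n) (λ u → *-zeroˡ (H u))) (ΣL-zero (allWords p n)))
  ΣL-support {p} {n} ((r , u₀) ∷ x) H = begin
      r * H u₀ + ΣL x (λ e → proj₁ e * H (proj₂ e))
    ≡⟨ cong₂ _+_ (sym (trans (ΣL-*ˡ W r _) (cong (r *_) (ΣL-allWords-δ u₀ H)))) (ΣL-support x H) ⟩
      ΣL W (λ u → r * (𝟙⟨ does (u₀ ≟ʷ u) ⟩ * H u)) + ΣL W (λ u → coeff x u * H u)
    ≡⟨ sym (ΣL-+ W _ _) ⟩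
      ΣL W (λ u → r * (𝟙⟨ does (u₀ ≟ʷ u) ⟩ * H u) + coeff x u * H u)
    ≡⟨ ΣL-cong W step ⟩
      ΣL W (λ u → coeff ((r , u₀) ∷ x) u * H u) ∎
    where
    open ≡-Reasoning
    W : List (Word p n)
    W = allWords p n
    step : ∀ u → r * (𝟙⟨ does (u₀ ≟ʷ u) ⟩ * H u) + coeff x u * H u ≡ coeff ((r , u₀) ∷ x) u * H u
    step u with does (u₀ ≟ʷ u)
    ... | true = trans (cong (λ z → r * z + coeff x u * H u) (*-identityˡ (H u))) (sym (*-distribʳ-+ (H u) r (coeff x u)))
    ... | false = trans (cong (λ z → r * z + coeff x u * H u) (*-zeroˡ (H u))) (trans (cong (_+ coeff x u * H u) (*-zeroʳ r)) (+-identityˡ _))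

module Insertion where

  open Coefficients using (leftMul)
  open import Data.Nat as ℕ using (ℕ; zero; suc; NonZero; _+_; _∸_; _<_; _≤_; z≤n; s≤s; _%_)
  open import Data.Nat.Properties
  open import Data.Nat.DivMod
  open import Data.Fin using (Fin; toℕ)
  open import Data.Fin.Properties using (toℕ-fromℕ<; toℕ-injective; toℕ<n)
  open import Data.Vec as Vec using (Vec; lookup)
  import Data.Vec.Properties as VecP
  open import Data.Product using (_×_; _,_; proj₁; proj₂)
  open import Data.List using ([]; _∷_)
  open import Data.Bool using (true; false)
  open import Relation.Nullary using (does)
  open import Relation.Binary.PropositionalEquality
  open import Data.Empty using (⊥-elim)
  import Data.Rational as ℚ

  ν : {p n : ℕ} → Letter p n → ℕ × ℕ
  ν (a , j) = (toℕ a , toℕ j)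

  ν-injective : {p n : ℕ} {l l′ : Letter p n} → ν l ≡ ν l′ → l ≡ l′
  ν-injective {l = a , j} {a′ , j′} eq = cong₂ _,_ (toℕ-injective (cong proj₁ eq)) (toℕ-injective (cong proj₂ eq))

  toℕ-mod : ∀ m n .{{_ : NonZero n}} → toℕ (m mod n) ≡ m % n
  toℕ-mod m n = toℕ-fromℕ< (m%n<n m n)

  toℕ-𝟎 : ∀ {p} .{{_ : NonZero p}} → toℕ (𝟎 {p}) ≡ 0
  toℕ-𝟎 {p} = trans (toℕ-mod 0 p) (m<n⇒m%n≡m (ℕ.>-nonZero⁻¹ p))

  -- An unindexed three-way comparison, so that φ and ψ below compute by pattern matching.
  data Cmp : Set where
    lt eq gt : Cmp

  cmp : ℕ → ℕ → Cmp
  cmp zero zero = eq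
  cmp zero (suc _) = lt
  cmp (suc _) zero = gt
  cmp (suc a) (suc b) = cmp a b

  cmp-lt : ∀ a b → cmp a b ≡ lt → a < b
  cmp-lt zero (suc b) _ = s≤s z≤n
  cmp-lt (suc a) (suc b) e = s≤s (cmp-lt a b e)

  cmp-eq : ∀ a b → cmp a b ≡ eq → a ≡ b
  cmp-eq zero zero _ = refl
  cmp-eq (suc a) (suc b) e = cong suc (cmp-eq a b e)

  cmp-gt : ∀ a b → cmp a b ≡ gt → b < a
  cmp-gt (suc a) zero _ = s≤s z≤n
  cmp-gt (suc a) (suc b) e = s≤s (cmp-gt a b e)

  <⇒cmp-lt : ∀ {a b} → a < b → cmp a b ≡ lt
  <⇒cmp-lt {zero} {suc b} _ = refl
  <⇒cmp-lt {suc a} {suc b} (s≤s a<b) = <⇒cmp-lt a<b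

  cmp-refl : ∀ a → cmp a a ≡ eq
  cmp-refl zero = refl
  cmp-refl (suc a) = cmp-refl a

  >⇒cmp-gt : ∀ {a b} → b < a → cmp a b ≡ gt
  >⇒cmp-gt {suc a} {zero} _ = refl
  >⇒cmp-gt {suc a} {suc b} (s≤s b<a) = >⇒cmp-gt b<a

  -- Left multiplication by the summand of B₁ whose new letter (c , 0) sits at index t acts letterwise by φ:
  -- positions j < t move up by one, position t becomes 0 (and takes colour c), positions j > t stay.
  -- ψ is its inverse; all positions and colours are computed on ℕ and reduced mod n and p.
  φpos′ : Cmp → ℕ → ℕ
  φpos′ lt j = suc j
  φpos′ eq j = zero
  φpos′ gt j = j

  φpos : ℕ → ℕ → ℕ
  φpos t j = φpos′ (cmp j t) j

  φcol′ : (p c x : ℕ) .{{_ : NonZero p}} → Cmp → ℕ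
  φcol′ p c x eq = (c + x) % p
  φcol′ p c x _ = x

  φcol : (p c t x j : ℕ) .{{_ : NonZero p}} → ℕ
  φcol p c t x j = φcol′ p c x (cmp j t)

  ψpos′ : Cmp → ℕ → ℕ
  ψpos′ lt m = m
  ψpos′ _ m = suc m

  ψpos : ℕ → ℕ → ℕ
  ψpos t zero = t
  ψpos t (suc m) = ψpos′ (cmp m t) m

  ψcol : (p c x m : ℕ) .{{_ : NonZero p}} → ℕ
  ψcol p c x zero = (x + (p ∸ c)) % p
  ψcol p c x (suc m) = x

  φℕ : (p c t : ℕ) .{{_ : NonZero p}} → ℕ × ℕ → ℕ × ℕ
  φℕ p c t (x , j) = (φcol p c t x j , φpos t j)

  ψℕ : (p c t : ℕ) .{{_ : NonZero p}} → ℕ × ℕ → ℕ × ℕ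
  ψℕ p c t (x , m) = (ψcol p c x m , ψpos t m)

  module _ {p n : ℕ} .{{_ : NonZero p}} .{{_ : NonZero n}} where
    φL : ℕ → ℕ → Letter p n → Letter p n
    φL c t (a , j) = (φcol p c t (toℕ a) (toℕ j) mod p , φpos t (toℕ j) mod n)

    ψL : ℕ → ℕ → Letter p n → Letter p n
    ψL c t (a , j) = (ψcol p c (toℕ a) (toℕ j) mod p , ψpos t (toℕ j) mod n)

    insertion : ℕ → ℕ → Word p n
    insertion c t = Vec.map (φL c t) idW

    ψW : ℕ → ℕ → Word p n → Word p n
    ψW c t w = Vec.map (ψL c t) w

  modˡ : ∀ a b p .{{_ : NonZero p}} → (a % p + b) % p ≡ (a + b) % p
  modˡ a b p = trans (%-distribˡ-+ (a % p) b p) (trans (cong (λ z → (z + b % p) % p) (m%n%n≡m%n a p)) (sym (%-distribˡ-+ a b p)))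

  modʳ : ∀ a b p .{{_ : NonZero p}} → (a + b % p) % p ≡ (a + b) % p
  modʳ a b p = trans (cong (_% p) (+-comm a (b % p))) (trans (modˡ b a p) (cong (_% p) (+-comm b a)))

  ψcol<p : ∀ p c x m .{{_ : NonZero p}} → x < p → ψcol p c x m < p
  ψcol<p p c x zero x<p = m%n<n _ p
  ψcol<p p c x (suc m) x<p = x<p

  ψpos<n : ∀ {n} t m → t < n → m < n → ψpos t m < n
  ψpos<n t zero t<n m<n = t<n
  ψpos<n t (suc m) t<n m<n with cmp m t
  ... | lt = <-trans (n<1+n m) m<n
  ... | eq = m<n
  ... | gt = m<n

  φpos<n : ∀ {n} t j → t < n → j < n → φpos t j < n
  φpos<n t j t<n j<n with cmp j t in e
  ... | lt = ≤-trans (s≤s (cmp-lt j t e)) t<n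
  ... | eq = ≤-trans (s≤s z≤n) j<n
  ... | gt = j<n

  φcol<p : ∀ p c t x j .{{_ : NonZero p}} → x < p → φcol p c t x j < p
  φcol<p p c t x j x<p with cmp j t
  ... | lt = x<p
  ... | eq = m%n<n _ p
  ... | gt = x<p

  module _ {p n : ℕ} .{{_ : NonZero p}} .{{_ : NonZero n}} where
    ν-ψL : ∀ c t (l : Letter p n) → t < n → ν (ψL c t l) ≡ ψℕ p c t (ν l)
    ν-ψL c t (a , j) t<n = cong₂ _,_
      (trans (toℕ-mod _ p) (m<n⇒m%n≡m (ψcol<p p c (toℕ a) (toℕ j) (toℕ<n a))))
      (trans (toℕ-mod _ n) (m<n⇒m%n≡m (ψpos<n t (toℕ j) t<n (toℕ<n j))))

    ν-φL : ∀ c t (l : Letter p n) → t < n → ν (φL c t l) ≡ φℕ p c t (ν l)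
    ν-φL c t (a , j) t<n = cong₂ _,_
      (trans (toℕ-mod _ p) (m<n⇒m%n≡m (φcol<p p c t (toℕ a) (toℕ j) (toℕ<n a))))
      (trans (toℕ-mod _ n) (m<n⇒m%n≡m (φpos<n t (toℕ j) t<n (toℕ<n j))))

  private
    c+x+[p∸c]≡x+p : ∀ c x p → c ≤ p → c + x + (p ∸ c) ≡ x + p
    c+x+[p∸c]≡x+p c x p c≤p = trans (cong (_+ (p ∸ c)) (+-comm c x)) (trans (+-assoc x c (p ∸ c)) (cong (x +_) (m+[n∸m]≡n c≤p)))

  ψℕ∘φℕ : ∀ p c t x j .{{_ : NonZero p}} → c < p → x < p → ψℕ p c t (φℕ p c t (x , j)) ≡ (x , j)
  ψℕ∘φℕ p c t x j c<p x<p with cmp j t in e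
  ... | lt rewrite e = refl
  ... | eq = cong₂ _,_ (begin
      ((c + x) % p + (p ∸ c)) % p ≡⟨ modˡ (c + x) (p ∸ c) p ⟩
      (c + x + (p ∸ c)) % p       ≡⟨ cong (_% p) (c+x+[p∸c]≡x+p c x p (<⇒≤ c<p)) ⟩
      (x + p) % p                 ≡⟨ [m+n]%n≡m%n x p ⟩
      x % p                       ≡⟨ m<n⇒m%n≡m x<p ⟩
      x                           ∎) (sym (cmp-eq j t e))
    where open ≡-Reasoning
  ψℕ∘φℕ p c t x zero c<p x<p | gt = ⊥-elim (n≮0 (cmp-gt zero t e))
  ψℕ∘φℕ p c t x (suc j) c<p x<p | gt with cmp j t in e₂
  ... | lt = ⊥-elim (<-irrefl refl (≤-<-trans (ℕ.s≤s⁻¹ (cmp-gt (suc j) t e)) (cmp-lt j t e₂)))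
  ... | eq = refl
  ... | gt = refl

  φℕ∘ψℕ : ∀ p c t x m .{{_ : NonZero p}} → c < p → x < p → φℕ p c t (ψℕ p c t (x , m)) ≡ (x , m)
  φℕ∘ψℕ p c t x zero c<p x<p rewrite cmp-refl t = cong (_, zero) (begin
      (c + (x + (p ∸ c)) % p) % p ≡⟨ modʳ c (x + (p ∸ c)) p ⟩
      (c + (x + (p ∸ c))) % p     ≡⟨ cong (_% p) (trans (sym (+-assoc c x (p ∸ c))) (c+x+[p∸c]≡x+p c x p (<⇒≤ c<p))) ⟩
      (x + p) % p                 ≡⟨ [m+n]%n≡m%n x p ⟩
      x % p                       ≡⟨ m<n⇒m%n≡m x<p ⟩
      x                           ∎)
    where open ≡-Reasoning
  φℕ∘ψℕ p c t x (suc m) c<p x<p with cmp m t in e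
  ... | lt rewrite e = refl
  ... | eq rewrite cmp-eq m t e | >⇒cmp-gt (n<1+n t) = refl
  ... | gt rewrite >⇒cmp-gt (<-trans (cmp-gt m t e) (n<1+n m)) = refl

  module _ {p n : ℕ} .{{_ : NonZero p}} .{{_ : NonZero n}} (c t : ℕ) (c<p : c < p) (t<n : t < n) where
    φL∘ψL : (l : Letter p n) → φL c t (ψL c t l) ≡ l
    φL∘ψL (a , j) = ν-injective (trans (ν-φL c t (ψL c t (a , j)) t<n)
      (trans (cong (φℕ p c t) (ν-ψL c t (a , j) t<n)) (φℕ∘ψℕ p c t (toℕ a) (toℕ j) c<p (toℕ<n a))))

    ψL∘φL : (l : Letter p n) → ψL c t (φL c t l) ≡ l
    ψL∘φL (a , j) = ν-injective (trans (ν-ψL c t (φL c t (a , j)) t<n)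
      (trans (cong (ψℕ p c t) (ν-φL c t (a , j) t<n)) (ψℕ∘φℕ p c t (toℕ a) (toℕ j) c<p (toℕ<n a))))

    map-φL∘ψL : {k : ℕ} (w : Vec (Letter p n) k) → Vec.map (φL c t) (Vec.map (ψL c t) w) ≡ w
    map-φL∘ψL w = trans (sym (VecP.map-∘ (φL c t) (ψL c t) w)) (trans (VecP.map-cong φL∘ψL w) (VecP.map-id w))

    map-ψL∘φL : {k : ℕ} (w : Vec (Letter p n) k) → Vec.map (ψL c t) (Vec.map (φL c t) w) ≡ w
    map-ψL∘φL w = trans (sym (VecP.map-∘ (ψL c t) (φL c t) w)) (trans (VecP.map-cong ψL∘φL w) (VecP.map-id w))

    private
      colour : ∀ x k → x < p → (φcol′ p c 0 k % p + x) % p ≡ φcol′ p c x k % p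
      colour x lt x<p = cong (λ z → (z + x) % p) (m<n⇒m%n≡m (ℕ.>-nonZero⁻¹ p))
      colour x gt x<p = cong (λ z → (z + x) % p) (m<n⇒m%n≡m (ℕ.>-nonZero⁻¹ p))
      colour x eq x<p = trans (modˡ ((c + 0) % p) x p) (trans (modˡ (c + 0) x p)
        (trans (cong (λ z → (z + x) % p) (+-identityʳ c)) (sym (m%n%n≡m%n (c + x) p))))

      lookup-insertion : (j : Fin n) → lookup (insertion {p} {n} c t) j ≡ φL c t (𝟎 {p} , j)
      lookup-insertion j = trans (VecP.lookup-map j (φL c t) idW) (cong (φL c t) (VecP.lookup∘tabulate (λ (i : Fin n) → (𝟎 {p} , i)) j))

    insertion-· : (v : Word p n) → insertion c t · v ≡ Vec.map (φL c t) v
    insertion-· v = VecP.map-cong letter v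
      where
      letter : (l : Letter p n) → (proj₁ (lookup (insertion {p} {n} c t) (proj₂ l)) ⊕ proj₁ l , proj₂ (lookup (insertion {p} {n} c t) (proj₂ l))) ≡ φL c t l
      letter (a , j) = trans (cong (λ q → (proj₁ q ⊕ a , proj₂ q)) (lookup-insertion j))
        (ν-injective (cong (_, toℕ (φpos t (toℕ j) mod n)) (begin
          toℕ (proj₁ (φL c t (𝟎 , j)) ⊕ a)                          ≡⟨ toℕ-mod _ p ⟩
          (toℕ (φcol p c t (toℕ (𝟎 {p})) (toℕ j) mod p) + toℕ a) % p ≡⟨ cong (λ z → (z + toℕ a) % p) (toℕ-mod _ p) ⟩
          (φcol p c t (toℕ (𝟎 {p})) (toℕ j) % p + toℕ a) % p        ≡⟨ cong (λ z → (φcol p c t z (toℕ j) % p + toℕ a) % p) toℕ-𝟎 ⟩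
          (φcol p c t 0 (toℕ j) % p + toℕ a) % p                    ≡⟨ colour (toℕ a) (cmp (toℕ j) t) (toℕ<n a) ⟩
          φcol p c t (toℕ a) (toℕ j) % p                            ≡⟨ sym (toℕ-mod _ p) ⟩
          toℕ (φcol p c t (toℕ a) (toℕ j) mod p)                    ∎)))
        where open ≡-Reasoning

    insertion-·≡⇔ : (v w : Word p n) → (insertion c t · v ≡ w) ⇔ (v ≡ ψW c t w)
    insertion-·≡⇔ v w = mk⇔ (λ e → trans (sym (map-ψL∘φL v)) (cong (Vec.map (ψL c t)) (trans (sym (insertion-· v)) e)))
                            (λ e → trans (insertion-· v) (trans (cong (Vec.map (φL c t)) e) (map-φL∘ψL w)))

    coeff-leftMul-insertion : (y : QG p n) (w : Word p n) → coeff (leftMul (insertion c t) y) w ≡ coeff y (ψW c t w)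
    coeff-leftMul-insertion [] w = refl
    coeff-leftMul-insertion ((s , v) ∷ y) w
      rewrite does-⇔ (insertion-·≡⇔ v w) ((insertion c t · v) ≟ʷ w) (v ≟ʷ ψW c t w)
      with does (v ≟ʷ ψW c t w)
    ... | true = cong (s ℚ.+_) (coeff-leftMul-insertion y w)
    ... | false = coeff-leftMul-insertion y w

module ListFacts where

  open import Data.Nat as ℕ using (ℕ; zero; suc; _<_; _≤_; z≤n; s≤s; _≤ᵇ_; _<ᵇ_; _≡ᵇ_)
  open import Data.Nat.Properties
  open import Data.List as List using (List; []; _∷_; _++_; map; length; filterᵇ)
  import Data.List.Properties as ListP
  open import Data.List.Relation.Unary.All as All using (All; []; _∷_)
  open import Data.List.Relation.Unary.All.Properties using (¬Any⇒All¬)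
  open import Data.List.Relation.Unary.Any as Any using (Any; here; there)
  open import Data.List.Relation.Unary.AllPairs using ([]; _∷_)
  open import Data.List.Relation.Unary.Unique.Propositional using (Unique)
  open import Data.Bool using (Bool; true; false; _∧_; not; T)
  open import Data.Bool.Properties using (T-≡; ¬-not)
  open import Data.Product using (_×_; _,_; proj₂)
  open import Relation.Binary.PropositionalEquality
  open import Relation.Nullary using (¬_; yes; no)
  open import Data.Empty using (⊥-elim)
  open import Function using (_∘_; id)

  T⇒≡true : ∀ {b} → T b → b ≡ true
  T⇒≡true = Equivalence.to T-≡

  ¬T⇒≡false : ∀ {b} → ¬ T b → b ≡ false
  ¬T⇒≡false ¬t = ¬-not (λ e → ¬t (Equivalence.from T-≡ e))

  ≤⇒≤ᵇ≡true : ∀ {a m} → a ≤ m → (a ≤ᵇ m) ≡ true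
  ≤⇒≤ᵇ≡true a≤m = T⇒≡true (≤⇒≤ᵇ a≤m)

  >⇒≤ᵇ≡false : ∀ {a m} → m < a → (a ≤ᵇ m) ≡ false
  >⇒≤ᵇ≡false {a} {m} m<a = ¬T⇒≡false (λ t → <⇒≱ m<a (≤ᵇ⇒≤ a m t))

  <⇒<ᵇ≡true : ∀ {a m} → a < m → (a <ᵇ m) ≡ true
  <⇒<ᵇ≡true a<m = T⇒≡true (<⇒<ᵇ a<m)

  ≥⇒<ᵇ≡false : ∀ {a m} → m ≤ a → (a <ᵇ m) ≡ false
  ≥⇒<ᵇ≡false {a} {m} m≤a = ¬T⇒≡false (λ t → ≤⇒≯ m≤a (<ᵇ⇒< a m t))

  <ᵇ≡true⇒< : ∀ {a m} → (a <ᵇ m) ≡ true → a < m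
  <ᵇ≡true⇒< {a} {m} e = <ᵇ⇒< a m (subst T (sym e) _)

  <ᵇ≡false⇒≥ : ∀ {a m} → (a <ᵇ m) ≡ false → m ≤ a
  <ᵇ≡false⇒≥ e = ≮⇒≥ (λ a<m → subst T e (<⇒<ᵇ a<m))

  ≤ᵇ-suc : ∀ a m → (a ≤ᵇ m) ≡ (a <ᵇ suc m)
  ≤ᵇ-suc zero m = refl
  ≤ᵇ-suc (suc a) m = refl

  ≤ᵇ≡not<ᵇ : ∀ a m → (a ≤ᵇ m) ≡ not (m <ᵇ a)
  ≤ᵇ≡not<ᵇ zero m = refl
  ≤ᵇ≡not<ᵇ (suc a) zero = refl
  ≤ᵇ≡not<ᵇ (suc a) (suc m) = trans (sym (≤ᵇ-suc a m)) (≤ᵇ≡not<ᵇ a m)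

  ≡ᵇ≡true⇒≡ : ∀ {x k} → (x ≡ᵇ k) ≡ true → x ≡ k
  ≡ᵇ≡true⇒≡ {x} {k} e = ≡ᵇ⇒≡ x k (subst T (sym e) _)

  ≡ᵇ≡false⇒≢ : ∀ {x k} → (x ≡ᵇ k) ≡ false → x ≢ k
  ≡ᵇ≡false⇒≢ {x} {k} e x≡k = subst T e (≡⇒≡ᵇ x k x≡k)

  ≡ᵇ-refl : ∀ x → (x ≡ᵇ x) ≡ true
  ≡ᵇ-refl x = T⇒≡true (≡⇒≡ᵇ x x refl)

  All-universal : {A : Set} {P : A → Set} (xs : List A) → (∀ x → P x) → All P xs
  All-universal xs f = All.tabulate (λ {x} _ → f x)

  module _ {A : Set} where
    filterᵇ-cong : (q r : A → Bool) (xs : List A) → All (λ x → q x ≡ r x) xs → filterᵇ q xs ≡ filterᵇ r xs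
    filterᵇ-cong q r [] [] = refl
    filterᵇ-cong q r (x ∷ xs) (e ∷ es) with q x | r x
    ... | true | true = cong (x ∷_) (filterᵇ-cong q r xs es)
    ... | false | false = filterᵇ-cong q r xs es
    filterᵇ-cong q r (x ∷ xs) (() ∷ es) | true | false
    filterᵇ-cong q r (x ∷ xs) (() ∷ es) | false | true

    filterᵇ-all : (q : A → Bool) (xs : List A) → All (λ x → q x ≡ true) xs → filterᵇ q xs ≡ xs
    filterᵇ-all q [] [] = refl
    filterᵇ-all q (x ∷ xs) (e ∷ es) with q x
    ... | true = cong (x ∷_) (filterᵇ-all q xs es)
    filterᵇ-all q (x ∷ xs) (() ∷ es) | false

    filterᵇ-none : (q : A → Bool) (xs : List A) → All (λ x → q x ≡ false) xs → filterᵇ q xs ≡ []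
    filterᵇ-none q [] [] = refl
    filterᵇ-none q (x ∷ xs) (e ∷ es) with q x
    ... | false = filterᵇ-none q xs es
    filterᵇ-none q (x ∷ xs) (() ∷ es) | true

    filterᵇ-accept : (q : A → Bool) {x : A} {xs : List A} → q x ≡ true → filterᵇ q (x ∷ xs) ≡ x ∷ filterᵇ q xs
    filterᵇ-accept q e rewrite e = refl

    filterᵇ-reject : (q : A → Bool) {x : A} {xs : List A} → q x ≡ false → filterᵇ q (x ∷ xs) ≡ filterᵇ q xs
    filterᵇ-reject q e rewrite e = refl

    filterᵇ≡[]⇒none : (q : A → Bool) (xs : List A) → filterᵇ q xs ≡ [] → All (λ x → q x ≡ false) xs
    filterᵇ≡[]⇒none q [] e = []
    filterᵇ≡[]⇒none q (x ∷ xs) e with q x in eq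
    filterᵇ≡[]⇒none q (x ∷ xs) () | true
    ... | false = eq ∷ filterᵇ≡[]⇒none q xs e

    filterᵇ-filterᵇ : (q r : A → Bool) (xs : List A) → filterᵇ q (filterᵇ r xs) ≡ filterᵇ (λ x → r x ∧ q x) xs
    filterᵇ-filterᵇ q r [] = refl
    filterᵇ-filterᵇ q r (x ∷ xs) with r x
    ... | false = filterᵇ-filterᵇ q r xs
    ... | true with q x
    ...   | true = cong (x ∷_) (filterᵇ-filterᵇ q r xs)
    ...   | false = filterᵇ-filterᵇ q r xs

    All-filterᵇ-true : (q : A → Bool) (xs : List A) → All (λ x → q x ≡ true) (filterᵇ q xs)
    All-filterᵇ-true q [] = []
    All-filterᵇ-true q (x ∷ xs) with q x in e
    ... | true = e ∷ All-filterᵇ-true q xs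
    ... | false = All-filterᵇ-true q xs

    Any-filterᵇ : {P : A → Set} (q : A → Bool) {xs : List A} → All (λ x → P x → q x ≡ true) xs → Any P xs → Any P (filterᵇ q xs)
    Any-filterᵇ q {x ∷ xs} (h ∷ hs) (here px) with q x | h px
    ... | true | _ = here px
    Any-filterᵇ q {x ∷ xs} (h ∷ hs) (there a) with q x
    ... | true = there (Any-filterᵇ q hs a)
    ... | false = Any-filterᵇ q hs a

    length-filterᵇ-not : (q : A → Bool) (xs : List A) → length (filterᵇ q xs) ℕ.+ length (filterᵇ (not ∘ q) xs) ≡ length xs
    length-filterᵇ-not q [] = refl
    length-filterᵇ-not q (x ∷ xs) with q x
    ... | true = cong suc (length-filterᵇ-not q xs)
    ... | false = trans (+-suc _ _) (cong suc (length-filterᵇ-not q xs))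

  module _ {A B : Set} where
    filterᵇ-map : (q : B → Bool) (f : A → B) (xs : List A) → filterᵇ q (map f xs) ≡ map f (filterᵇ (q ∘ f) xs)
    filterᵇ-map q f [] = refl
    filterᵇ-map q f (x ∷ xs) with q (f x)
    ... | true = cong (f x ∷_) (filterᵇ-map q f xs)
    ... | false = filterᵇ-map q f xs

    map-congᴬ : {f g : A → B} (xs : List A) → All (λ x → f x ≡ g x) xs → map f xs ≡ map g xs
    map-congᴬ [] [] = refl
    map-congᴬ (x ∷ xs) (e ∷ es) = cong₂ _∷_ e (map-congᴬ xs es)

    All-map-filterᵇ : {P : B → Set} (f : A → B) (q : A → Bool) {xs : List A} → All P (map f xs) → All P (map f (filterᵇ q xs))
    All-map-filterᵇ f q {[]} [] = []
    All-map-filterᵇ f q {x ∷ xs} (px ∷ ps) with q x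
    ... | true = px ∷ All-map-filterᵇ f q ps
    ... | false = All-map-filterᵇ f q ps

    Unique-map-filterᵇ : (f : A → B) (q : A → Bool) {xs : List A} → Unique (map f xs) → Unique (map f (filterᵇ q xs))
    Unique-map-filterᵇ f q {[]} [] = []
    Unique-map-filterᵇ f q {x ∷ xs} (h ∷ u) with q x
    ... | true = All-map-filterᵇ f q h ∷ Unique-map-filterᵇ f q u
    ... | false = Unique-map-filterᵇ f q u

  module _ {A : Set} (f : A → ℕ) (a : ℕ) where
    private
      below : A → Bool
      below l = f l <ᵇ a

      All-map-merge : (R : ℕ → Set) (q : A → Bool) (xs : List A) →
        (∀ z → q z ≡ false → R (f z)) → All R (map f (filterᵇ q xs)) → All R (map f xs)
      All-map-merge R q [] h r = []
      All-map-merge R q (x ∷ xs) h r with q x in e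
      All-map-merge R q (x ∷ xs) h (r ∷ rs) | true = r ∷ All-map-merge R q xs h rs
      All-map-merge R q (x ∷ xs) h rs | false = h x e ∷ All-map-merge R q xs h rs

      not-below : ∀ {l} → not (below l) ≡ false → f l < a
      not-below {l} e with below l in e₂
      ... | true = <ᵇ≡true⇒< {f l} {a} e₂

    Unique-map-partition : (xs : List A) → Unique (map f (filterᵇ below xs)) → Unique (map f (filterᵇ (not ∘ below) xs)) → Unique (map f xs)
    Unique-map-partition [] u₁ u₂ = []
    Unique-map-partition (x ∷ xs) u₁ u₂ with below x in e
    Unique-map-partition (x ∷ xs) (h ∷ u₁) u₂ | true =
      All-map-merge (f x ≢_) below xs (λ z ez eq → <-irrefl eq (<-≤-trans (<ᵇ≡true⇒< {f x} {a} e) (<ᵇ≡false⇒≥ {f z} {a} ez))) h ∷ Unique-map-partition xs u₁ u₂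
    Unique-map-partition (x ∷ xs) u₁ (h ∷ u₂) | false =
      All-map-merge (f x ≢_) (not ∘ below) xs (λ z ez eq → <-irrefl (sym eq) (<-≤-trans (not-below ez) (<ᵇ≡false⇒≥ {f x} {a} e))) h ∷ Unique-map-partition xs u₁ u₂

  private
    ≢ᵇ : ℕ → ℕ → Bool
    ≢ᵇ k x = not (x ≡ᵇ k)

    Unique-filter-≢ᵇ : ∀ k (xs : List ℕ) → Unique xs → Unique (filterᵇ (≢ᵇ k) xs)
    Unique-filter-≢ᵇ k xs u = subst Unique (ListP.map-id _) (Unique-map-filterᵇ id (≢ᵇ k) (subst Unique (sym (ListP.map-id xs)) u))

    length≤1+length-filter-≢ᵇ : ∀ k (xs : List ℕ) → Unique xs → length xs ≤ suc (length (filterᵇ (≢ᵇ k) xs))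
    length≤1+length-filter-≢ᵇ k [] [] = z≤n
    length≤1+length-filter-≢ᵇ k (x ∷ xs) (h ∷ u) with x ≡ᵇ k in e
    ... | true = s≤s (≤-reflexive (cong length (sym (filterᵇ-all _ xs (All.map ≢k h)))))
      where
      ≢k : ∀ {y} → x ≢ y → ≢ᵇ k y ≡ true
      ≢k {y} x≢y with y ≡ᵇ k in e₂
      ... | true = ⊥-elim (x≢y (trans (≡ᵇ≡true⇒≡ e) (sym (≡ᵇ≡true⇒≡ e₂))))
      ... | false = refl
    ... | false = s≤s (length≤1+length-filter-≢ᵇ k xs u)

    filter-≢ᵇ-< : ∀ k (xs : List ℕ) → All (_< suc k) xs → All (_< k) (filterᵇ (≢ᵇ k) xs)
    filter-≢ᵇ-< k [] [] = []
    filter-≢ᵇ-< k (x ∷ xs) (x<sk ∷ a) with x ≡ᵇ k in e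
    ... | true = filter-≢ᵇ-< k xs a
    ... | false = ≤∧≢⇒< (ℕ.s≤s⁻¹ x<sk) (≡ᵇ≡false⇒≢ e) ∷ filter-≢ᵇ-< k xs a

  Unique⇒length≤ : ∀ k (xs : List ℕ) → Unique xs → All (_< k) xs → length xs ≤ k
  Unique⇒length≤ zero [] u a = z≤n
  Unique⇒length≤ zero (x ∷ xs) u (() ∷ a)
  Unique⇒length≤ (suc k) xs u a = ≤-trans (length≤1+length-filter-≢ᵇ k xs u)
    (s≤s (Unique⇒length≤ k _ (Unique-filter-≢ᵇ k xs u) (filter-≢ᵇ-< k xs a)))

  private
    Unique-map-pred : ∀ (xs : List ℕ) → Unique xs → All (_≢ 0) xs → Unique (map ℕ.pred xs)
    Unique-map-pred [] [] [] = []
    Unique-map-pred (x ∷ xs) (h ∷ u) (x≢0 ∷ nzs) = distinct xs h nzs ∷ Unique-map-pred xs u nzs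
      where
      distinct : ∀ ys → All (x ≢_) ys → All (_≢ 0) ys → All (ℕ.pred x ≢_) (map ℕ.pred ys)
      distinct [] [] [] = []
      distinct (y ∷ ys) (x≢y ∷ h) (y≢0 ∷ nzs) = (λ e → x≢y (pred-injective {{ℕ.≢-nonZero x≢0}} {{ℕ.≢-nonZero y≢0}} e)) ∷ distinct ys h nzs

    All-map-pred-< : ∀ m ys → All (_< suc m) ys → All (_≢ 0) ys → All (_< m) (map ℕ.pred ys)
    All-map-pred-< m [] [] [] = []
    All-map-pred-< m (zero ∷ ys) (_ ∷ a) (z ∷ zs) = ⊥-elim (z refl)
    All-map-pred-< m (suc y ∷ ys) (sy<n ∷ a) (_ ∷ zs) = ℕ.s≤s⁻¹ sy<n ∷ All-map-pred-< m ys a zs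

  Unique⇒Any≡0 : ∀ n (xs : List ℕ) → Unique xs → All (_< n) xs → length xs ≡ n → 0 < n → Any (_≡ 0) xs
  Unique⇒Any≡0 (suc m) xs u a len _ with Any.any? (ℕ._≟ 0) xs
  ... | yes zero∈xs = zero∈xs
  ... | no zero∉xs = ⊥-elim (1+n≰n (≤-trans (≤-reflexive (trans (sym len) (sym (ListP.length-map ℕ.pred xs))))
        (Unique⇒length≤ m (map ℕ.pred xs) (Unique-map-pred xs u nz) (All-map-pred-< m xs a nz))))
    where
    nz : All (_≢ 0) xs
    nz = ¬Any⇒All¬ xs zero∉xs

  record ZeroSplit (G : List (ℕ × ℕ)) (Q : ℕ × ℕ → Set) : Set where
    constructor mkZeroSplit
    field
      G₁ G₂ : List (ℕ × ℕ)
      d : ℕ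
      split : G ≡ G₁ ++ (d , 0) ∷ G₂
      nz₁ : All (λ y → proj₂ y ≢ 0) G₁
      nz₂ : All (λ y → proj₂ y ≢ 0) G₂
      qd : Q (d , 0)

  zeroSplit : (Q : ℕ × ℕ → Set) (G : List (ℕ × ℕ)) → Unique (map proj₂ G) → All Q G → Any (λ y → proj₂ y ≡ 0) G → ZeroSplit G Q
  zeroSplit Q ((d , m) ∷ G) (h ∷ u) (q ∷ qs) (here refl) = mkZeroSplit [] G d refl [] (nz G h) q
    where
    nz : ∀ G → All (0 ≢_) (map proj₂ G) → All (λ y → proj₂ y ≢ 0) G
    nz [] [] = []
    nz (y ∷ G) (e ∷ es) = (e ∘ sym) ∷ nz G es
  zeroSplit Q (y ∷ G) (h ∷ u) (q ∷ qs) (there a) with zeroSplit Q G u qs a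
  ... | mkZeroSplit G₁ G₂ d refl nz₁ nz₂ qd = mkZeroSplit (y ∷ G₁) G₂ d refl (head≢0 h ∷ nz₁) nz₂ qd
    where
    head≢0 : ∀ {G₁} → All (proj₂ y ≢_) (map proj₂ (G₁ ++ (d , 0) ∷ G₂)) → proj₂ y ≢ 0
    head≢0 {[]} (e ∷ _) = e
    head≢0 {z ∷ G₁} (_ ∷ es) = head≢0 {G₁} es

module InsertionCount where
  open import Function using (_∘_)

  open Sums
  open import Data.Nat as ℕ using (ℕ; zero; suc; _<_; s≤s)
  open import Data.Rational using (ℚ; 0ℚ; _+_; _*_)
  open import Data.Rational.Properties
  open import Data.List using (List; []; _∷_; _++_; length)
  import Data.List.Properties as ListP
  open import Data.List.Relation.Unary.All using (All; []; _∷_)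
  import Data.Product.Properties as ProdP
  open import Data.Product using (_×_; _,_; proj₁; proj₂)
  open import Relation.Nullary using (does)
  open import Relation.Binary.Definitions using (DecidableEquality)
  open import Relation.Binary.PropositionalEquality

  _≟ᴾ_ : DecidableEquality (ℕ × ℕ)
  _≟ᴾ_ = ProdP.≡-dec ℕ._≟_ ℕ._≟_

  _≟ᴸ_ : DecidableEquality (List (ℕ × ℕ))
  _≟ᴸ_ = ListP.≡-dec _≟ᴾ_

  insertAt : {A : Set} → ℕ → A → List A → List A
  insertAt zero x V = x ∷ V
  insertAt (suc s) x [] = x ∷ []
  insertAt (suc s) x (v ∷ V) = v ∷ insertAt s x V

  PositionNonZero : ℕ × ℕ → Set
  PositionNonZero y = proj₂ y ≢ 0

  private
    𝟙-∷ : ∀ x y (X Y : List (ℕ × ℕ)) → 𝟙⟨ does ((x ∷ X) ≟ᴸ (y ∷ Y)) ⟩ ≡ 𝟙⟨ does (x ≟ᴾ y) ⟩ * 𝟙⟨ does (X ≟ᴸ Y) ⟩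
    𝟙-∷ x y X Y = 𝟙-∧ (does (x ≟ᴾ y)) (does (X ≟ᴸ Y))

    𝟙-∷-head≢ : ∀ x y (X Y : List (ℕ × ℕ)) → x ≢ y → 𝟙⟨ does ((x ∷ X) ≟ᴸ (y ∷ Y)) ⟩ ≡ 0ℚ
    𝟙-∷-head≢ x y X Y x≢y = 𝟙-no ((x ∷ X) ≟ᴸ (y ∷ Y)) (x≢y ∘ ListP.∷-injectiveˡ)

    Σ<-δ-colour : ∀ p d (K : ℚ) → d < p → Σ< p (λ c → 𝟙⟨ does ((d , 0) ≟ᴾ (c , 0)) ⟩ * K) ≡ K
    Σ<-δ-colour (suc p) zero K _ = trans (cong₂ _+_ (*-identityˡ K)
       (trans (Σ<-cong p (λ c _ → trans (cong (_* K) (𝟙-no ((0 , 0) ≟ᴾ (suc c , 0)) (λ ()))) (*-zeroˡ K))) (Σ<-zero p))) (+-identityʳ K)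
    Σ<-δ-colour (suc p) (suc d) K (s≤s d<p) = trans (cong₂ _+_ (trans (cong (_* K) (𝟙-no ((suc d , 0) ≟ᴾ (0 , 0)) (λ ()))) (*-zeroˡ K))
       (trans (Σ<-cong p (λ c _ → cong (λ z → 𝟙⟨ z ⟩ * K)
                 (does-⇔ (mk⇔ (cong (λ q → (ℕ.pred (proj₁ q) , 0))) (cong (λ q → (suc (proj₁ q) , 0)))) ((suc d , 0) ≟ᴾ (suc c , 0)) ((d , 0) ≟ᴾ (c , 0)))))
         (Σ<-δ-colour p d K d<p))) (+-identityˡ K)

  -- Only the unique letter of position 0 can be the inserted one, since neither G₁ nor V has a letter of position 0.
  Σ-insertAt : ∀ p d → d < p → (G₁ G₂ V : List (ℕ × ℕ)) → All PositionNonZero G₁ → All PositionNonZero V →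
    Σ< p (λ c → Σ< (suc (length V)) (λ s → 𝟙⟨ does ((G₁ ++ (d , 0) ∷ G₂) ≟ᴸ insertAt s (c , 0) V) ⟩))
      ≡ 𝟙⟨ does ((G₁ ++ G₂) ≟ᴸ V) ⟩
  Σ-insertAt p d d<p [] G₂ V _ nzV = begin
      Σ< p (λ c → 𝟙⟨ does (((d , 0) ∷ G₂) ≟ᴸ ((c , 0) ∷ V)) ⟩ + Σ< (length V) (λ s → 𝟙⟨ does (((d , 0) ∷ G₂) ≟ᴸ insertAt (suc s) (c , 0) V) ⟩))
    ≡⟨ Σ<-cong p (λ c _ → trans (cong₂ _+_ (𝟙-∷ (d , 0) (c , 0) G₂ V) (later c V nzV)) (+-identityʳ _)) ⟩
      Σ< p (λ c → 𝟙⟨ does ((d , 0) ≟ᴾ (c , 0)) ⟩ * 𝟙⟨ does (G₂ ≟ᴸ V) ⟩)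
    ≡⟨ Σ<-δ-colour p d 𝟙⟨ does (G₂ ≟ᴸ V) ⟩ d<p ⟩
      𝟙⟨ does (G₂ ≟ᴸ V) ⟩ ∎
    where
    open ≡-Reasoning
    later : ∀ c V → All PositionNonZero V → Σ< (length V) (λ s → 𝟙⟨ does (((d , 0) ∷ G₂) ≟ᴸ insertAt (suc s) (c , 0) V) ⟩) ≡ 0ℚ
    later c [] _ = refl
    later c (v ∷ V) (v≢0 ∷ _) = trans (Σ<-cong (suc (length V))
      (λ s _ → 𝟙-∷-head≢ (d , 0) v G₂ (insertAt s (c , 0) V) (λ e → v≢0 (sym (cong proj₂ e))))) (Σ<-zero (suc (length V)))
  Σ-insertAt p d d<p (g ∷ G₁) G₂ [] (g≢0 ∷ _) _ =
    trans (Σ<-cong p (λ c _ → trans (+-identityʳ _) (𝟙-∷-head≢ g (c , 0) (G₁ ++ (d , 0) ∷ G₂) [] (g≢0 ∘ cong proj₂)))) (Σ<-zero p)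
  Σ-insertAt p d d<p (g ∷ G₁) G₂ (v ∷ V) (g≢0 ∷ nz₁) (_ ∷ nzV) = begin
      Σ< p (λ c → 𝟙⟨ does ((g ∷ G) ≟ᴸ ((c , 0) ∷ v ∷ V)) ⟩ + Σ< (suc (length V)) (λ s → 𝟙⟨ does ((g ∷ G) ≟ᴸ (v ∷ insertAt s (c , 0) V)) ⟩))
    ≡⟨ Σ<-cong p (λ c _ → peel c) ⟩
      Σ< p (λ c → 𝟙⟨ does (g ≟ᴾ v) ⟩ * inner c)
    ≡⟨ Σ<-*ˡ p 𝟙⟨ does (g ≟ᴾ v) ⟩ inner ⟩
      𝟙⟨ does (g ≟ᴾ v) ⟩ * Σ< p inner
    ≡⟨ cong (𝟙⟨ does (g ≟ᴾ v) ⟩ *_) (Σ-insertAt p d d<p G₁ G₂ V nz₁ nzV) ⟩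
      𝟙⟨ does (g ≟ᴾ v) ⟩ * 𝟙⟨ does ((G₁ ++ G₂) ≟ᴸ V) ⟩
    ≡⟨ sym (𝟙-∷ g v (G₁ ++ G₂) V) ⟩
      𝟙⟨ does ((g ∷ G₁ ++ G₂) ≟ᴸ (v ∷ V)) ⟩ ∎
    where
    open ≡-Reasoning
    G : List (ℕ × ℕ)
    G = G₁ ++ (d , 0) ∷ G₂
    inner : ℕ → ℚ
    inner c = Σ< (suc (length V)) (λ s → 𝟙⟨ does (G ≟ᴸ insertAt s (c , 0) V) ⟩)
    peel : ∀ c → 𝟙⟨ does ((g ∷ G) ≟ᴸ ((c , 0) ∷ v ∷ V)) ⟩ + Σ< (suc (length V)) (λ s → 𝟙⟨ does ((g ∷ G) ≟ᴸ (v ∷ insertAt s (c , 0) V)) ⟩)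
               ≡ 𝟙⟨ does (g ≟ᴾ v) ⟩ * inner c
    peel c = begin
        𝟙⟨ does ((g ∷ G) ≟ᴸ ((c , 0) ∷ v ∷ V)) ⟩ + Σ< (suc (length V)) (λ s → 𝟙⟨ does ((g ∷ G) ≟ᴸ (v ∷ insertAt s (c , 0) V)) ⟩)
      ≡⟨ cong₂ _+_ (𝟙-∷-head≢ g (c , 0) G (v ∷ V) (λ e → g≢0 (cong proj₂ e))) (Σ<-cong (suc (length V)) (λ s _ → 𝟙-∷ g v G (insertAt s (c , 0) V))) ⟩
        0ℚ + Σ< (suc (length V)) (λ s → 𝟙⟨ does (g ≟ᴾ v) ⟩ * 𝟙⟨ does (G ≟ᴸ insertAt s (c , 0) V) ⟩)
      ≡⟨ trans (+-identityˡ _) (Σ<-*ˡ (suc (length V)) 𝟙⟨ does (g ≟ᴾ v) ⟩ (λ s → 𝟙⟨ does (G ≟ᴸ insertAt s (c , 0) V) ⟩)) ⟩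
        𝟙⟨ does (g ≟ᴾ v) ⟩ * inner c ∎

module Characteristic where

  open Sums
  open Insertion
  open ListFacts
  open InsertionCount
  open import Data.Nat as ℕ using (ℕ; zero; suc; NonZero; _+_; _∸_; _<_; _≤_; z≤n; s≤s; _≤ᵇ_; _<ᵇ_; _≡ᵇ_; _%_)
  open import Data.Nat.Properties
  open import Data.Nat.DivMod using (m<n⇒m%n≡m)
  open import Data.Fin.Properties using (toℕ<n)
  open import Data.Vec as Vec using (toList)
  import Data.Vec.Properties as VecP
  open import Data.List as List using (List; []; _∷_; map; length; filterᵇ)
  import Data.List.Properties as ListP
  open import Data.List.Relation.Unary.All as All using (All; []; _∷_)
  import Data.List.Relation.Unary.Unique.Propositional.Properties as UniqueP
  open import Data.List.Relation.Unary.Unique.DecPropositional ℕ._≟_ using (unique?)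
  open import Data.Product using (_×_; _,_; proj₁; proj₂)
  open import Data.Bool using (Bool; true; false; _∧_; _∨_; not; T)
  open import Data.Rational using (ℚ; _*_)
  open import Relation.Nullary using (does)
  open import Relation.Binary.PropositionalEquality
  open import Data.Empty using (⊥-elim)
  open import Function using (_∘_)

  range : ℕ → ℕ → List ℕ
  range a zero = []
  range a (suc k) = a ∷ range (suc a) k

  length-range : ∀ a k → length (range a k) ≡ k
  length-range a zero = refl
  length-range a (suc k) = cong suc (length-range (suc a) k)

  colourless : ℕ → ℕ × ℕ
  colourless j = (0 , j)

  module _ {p n : ℕ} where
    νL : Word p n → List (ℕ × ℕ)
    νL w = map ν (toList w)

    positions : Word p n → List ℕ
    positions w = map proj₂ (νL w)

    trailing : ℕ → Word p n → List (ℕ × ℕ)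
    trailing a w = filterᵇ (λ y → a ≤ᵇ proj₂ y) (νL w)

    identityTail : ℕ → List (ℕ × ℕ)
    identityTail a = map colourless (range a (n ∸ a))

    -- The coefficient of B_a at w, see coeff-B.
    β : ℕ → Word p n → ℚ
    β a w = 𝟙⟨ does (unique? (positions w)) ⟩ * 𝟙⟨ does (trailing a w ≟ᴸ identityTail a) ⟩

    νL-bounds : (w : Word p n) → All (λ y → proj₁ y < p × proj₂ y < n) (νL w)
    νL-bounds w = bounds (toList w)
      where
      bounds : (ls : List (Letter p n)) → All (λ y → proj₁ y < p × proj₂ y < n) (map ν ls)
      bounds [] = []
      bounds ((a , j) ∷ ls) = (toℕ<n a , toℕ<n j) ∷ bounds ls

    length-νL : (w : Word p n) → length (νL w) ≡ n
    length-νL w = trans (ListP.length-map ν (toList w)) (VecP.length-toList w)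

  φpos∘ψpos : ∀ t m → φpos t (ψpos t m) ≡ m
  φpos∘ψpos t m = cong proj₂ (φℕ∘ψℕ 1 0 t 0 m (s≤s z≤n) (s≤s z≤n))

  ψpos-injective : ∀ t {m m′} → ψpos t m ≡ ψpos t m′ → m ≡ m′
  ψpos-injective t {m} {m′} e = trans (sym (φpos∘ψpos t m)) (trans (cong (φpos t) e) (φpos∘ψpos t m′))

  -- the letters that ψ c (a + s) sends to positions ≥ a
  zeroOrAbove : ℕ → ℕ × ℕ → Bool
  zeroOrAbove a y = (proj₂ y ≡ᵇ 0) ∨ (a <ᵇ proj₂ y)

  module _ {p n : ℕ} .{{_ : NonZero p}} .{{_ : NonZero n}} where
    νL-ψW : ∀ c t → t < n → (w : Word p n) → νL (ψW c t w) ≡ map (ψℕ p c t) (νL w)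
    νL-ψW c t t<n w = begin
        map ν (toList (Vec.map (ψL c t) w)) ≡⟨ cong (map ν) (VecP.toList-map (ψL c t) w) ⟩
        map ν (map (ψL c t) (toList w))     ≡⟨ sym (ListP.map-∘ (toList w)) ⟩
        map (ν ∘ ψL c t) (toList w)         ≡⟨ ListP.map-cong (λ l → ν-ψL c t l t<n) (toList w) ⟩
        map (ψℕ p c t ∘ ν) (toList w)       ≡⟨ ListP.map-∘ (toList w) ⟩
        map (ψℕ p c t) (νL w)               ∎
      where open ≡-Reasoning

    unique-ψW : ∀ c t → t < n → (w : Word p n) → does (unique? (positions (ψW c t w))) ≡ does (unique? (positions w))
    unique-ψW c t t<n w rewrite cong (map proj₂) (νL-ψW c t t<n w) | sym (ListP.map-∘ {g = proj₂} {f = ψℕ p c t} (νL w))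
                                  | ListP.map-∘ {g = ψpos t} {f = proj₂} (νL w) =
      does-⇔ (mk⇔ UniqueP.map⁻ (UniqueP.map⁺ (ψpos-injective t))) (unique? (map (ψpos t) (positions w))) (unique? (positions w))

    trailing-ψW-below : ∀ a c t → t < n → t < a → (w : Word p n) → trailing a (ψW c t w) ≡ trailing a w
    trailing-ψW-below a c t t<n t<a w = begin
        filterᵇ (λ y → a ≤ᵇ proj₂ y) (νL (ψW c t w))
      ≡⟨ cong (filterᵇ (λ y → a ≤ᵇ proj₂ y)) (νL-ψW c t t<n w) ⟩
        filterᵇ (λ y → a ≤ᵇ proj₂ y) (map (ψℕ p c t) (νL w))
      ≡⟨ filterᵇ-map _ (ψℕ p c t) (νL w) ⟩
        map (ψℕ p c t) (filterᵇ (λ y → a ≤ᵇ ψpos t (proj₂ y)) (νL w))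
      ≡⟨ cong (map (ψℕ p c t)) (filterᵇ-cong _ _ (νL w) (All-universal (νL w) (λ y → same-test (proj₂ y)))) ⟩
        map (ψℕ p c t) (trailing a w)
      ≡⟨ map-congᴬ (trailing a w) (All.map (λ {y} e → fixed y e) (All-filterᵇ-true (λ y → a ≤ᵇ proj₂ y) (νL w))) ⟩
        map (λ y → y) (trailing a w)
      ≡⟨ ListP.map-id _ ⟩
        trailing a w ∎
      where
      open ≡-Reasoning
      same-test : ∀ m → (a ≤ᵇ ψpos t m) ≡ (a ≤ᵇ m)
      same-test zero = trans (>⇒≤ᵇ≡false t<a) (sym (>⇒≤ᵇ≡false (≤-<-trans z≤n t<a)))
      same-test (suc m) with cmp m t in e
      ... | lt = trans (>⇒≤ᵇ≡false (<-trans (cmp-lt m t e) t<a)) (sym (>⇒≤ᵇ≡false (≤-<-trans (cmp-lt m t e) t<a)))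
      ... | eq = refl
      ... | gt = refl
      fixed : ∀ y → (a ≤ᵇ proj₂ y) ≡ true → ψℕ p c t y ≡ y
      fixed (x , zero) e = ⊥-elim (subst T (trans (sym e) (>⇒≤ᵇ≡false (≤-<-trans z≤n t<a))) _)
      fixed (x , suc m) e with cmp m t in e₂
      ... | lt = ⊥-elim (subst T (trans (sym e) (>⇒≤ᵇ≡false (≤-<-trans (cmp-lt m t e₂) t<a))) _)
      ... | eq = refl
      ... | gt = refl

    trailing-ψW-above : ∀ a c t → t < n → a ≤ t → (w : Word p n) →
      trailing a (ψW c t w) ≡ map (ψℕ p c t) (filterᵇ (zeroOrAbove a) (νL w))
    trailing-ψW-above a c t t<n a≤t w = begin
        filterᵇ (λ y → a ≤ᵇ proj₂ y) (νL (ψW c t w))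
      ≡⟨ cong (filterᵇ (λ y → a ≤ᵇ proj₂ y)) (νL-ψW c t t<n w) ⟩
        filterᵇ (λ y → a ≤ᵇ proj₂ y) (map (ψℕ p c t) (νL w))
      ≡⟨ filterᵇ-map _ (ψℕ p c t) (νL w) ⟩
        map (ψℕ p c t) (filterᵇ (λ y → a ≤ᵇ ψpos t (proj₂ y)) (νL w))
      ≡⟨ cong (map (ψℕ p c t)) (filterᵇ-cong _ _ (νL w) (All-universal (νL w) (λ y → test (proj₂ y)))) ⟩
        map (ψℕ p c t) (filterᵇ (zeroOrAbove a) (νL w)) ∎
      where
      open ≡-Reasoning
      test : ∀ m → (a ≤ᵇ ψpos t m) ≡ zeroOrAbove a (0 , m)
      test zero = ≤⇒≤ᵇ≡true a≤t
      test (suc m) with cmp m t in e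
      ... | lt = ≤ᵇ-suc a m
      ... | eq = trans (≤⇒≤ᵇ≡true (≤-trans a≤t (≤-trans (≤-reflexive (sym (cmp-eq m t e))) (n≤1+n m))))
                       (sym (<⇒<ᵇ≡true (s≤s (≤-trans a≤t (≤-reflexive (sym (cmp-eq m t e)))))))
      ... | gt = trans (≤⇒≤ᵇ≡true (≤-trans a≤t (≤-trans (<⇒≤ (cmp-gt m t e)) (n≤1+n m))))
                       (sym (<⇒<ᵇ≡true (s≤s (≤-trans a≤t (<⇒≤ (cmp-gt m t e))))))

  filter-nonzero-zeroOrAbove : ∀ a (Y : List (ℕ × ℕ)) →
    filterᵇ (λ y → not (proj₂ y ≡ᵇ 0)) (filterᵇ (zeroOrAbove a) Y) ≡ filterᵇ (λ y → suc a ≤ᵇ proj₂ y) Y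
  filter-nonzero-zeroOrAbove a Y = trans (filterᵇ-filterᵇ _ (zeroOrAbove a) Y) (filterᵇ-cong _ _ Y (All-universal Y (λ y → test (proj₂ y))))
    where
    test : ∀ m → (zeroOrAbove a (0 , m) ∧ not (m ≡ᵇ 0)) ≡ (suc a ≤ᵇ m)
    test zero with a <ᵇ zero
    ... | true = refl
    ... | false = refl
    test (suc m) with a <ᵇ suc m
    ... | true = refl
    ... | false = refl

  module _ (p c : ℕ) .{{_ : NonZero p}} where
    private
      φ-above : ∀ t b k → t < b → map (φℕ p c t) (map colourless (range b k)) ≡ map colourless (range b k)
      φ-above t b zero t<b = refl
      φ-above t b (suc k) t<b rewrite >⇒cmp-gt t<b = cong ((0 , b) ∷_) (φ-above t (suc b) k (<-trans t<b (n<1+n b)))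

    φ-identityTail : c < p → ∀ a s M → s ≤ M →
      map (φℕ p c (a + s)) (map colourless (range a (suc M))) ≡ insertAt s (c , 0) (map colourless (range (suc a) M))
    φ-identityTail c<p a zero M z≤n rewrite +-identityʳ a | cmp-refl a =
      cong₂ _∷_ (cong (_, 0) (trans (cong (_% p) (+-identityʳ c)) (m<n⇒m%n≡m c<p))) (φ-above a (suc a) M (n<1+n a))
    φ-identityTail c<p a (suc s) (suc M) (s≤s s≤M) rewrite <⇒cmp-lt (m<m+n a {suc s} (s≤s z≤n)) =
      cong ((0 , suc a) ∷_) (trans (cong (λ t → map (φℕ p c t) (map colourless (range (suc a) (suc M)))) (+-suc a s))
        (φ-identityTail c<p (suc a) s M s≤M))

    ψℕ-≟-φℕ : ∀ t → c < p → (G W : List (ℕ × ℕ)) → All (λ y → proj₁ y < p) G → All (λ y → proj₁ y < p) W →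
      does (map (ψℕ p c t) G ≟ᴸ W) ≡ does (G ≟ᴸ map (φℕ p c t) W)
    ψℕ-≟-φℕ t c<p G W colG colW =
      does-⇔ (mk⇔ (λ e → trans (sym (φψ G colG)) (cong (map (φℕ p c t)) e)) (λ e → trans (cong (map (ψℕ p c t)) e) (ψφ W colW)))
             (map (ψℕ p c t) G ≟ᴸ W) (G ≟ᴸ map (φℕ p c t) W)
      where
      φψ : ∀ G → All (λ y → proj₁ y < p) G → map (φℕ p c t) (map (ψℕ p c t) G) ≡ G
      φψ [] [] = refl
      φψ ((x , m) ∷ G) (x<p ∷ a) = cong₂ _∷_ (φℕ∘ψℕ p c t x m c<p x<p) (φψ G a)
      ψφ : ∀ W → All (λ y → proj₁ y < p) W → map (ψℕ p c t) (map (φℕ p c t) W) ≡ W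
      ψφ [] [] = refl
      ψφ ((x , m) ∷ W) (x<p ∷ a) = cong₂ _∷_ (ψℕ∘φℕ p c t x m c<p x<p) (ψφ W a)

module ShiftCount where

  open Sums
  open NatEmbedding
  open Insertion
  open ListFacts
  open InsertionCount
  open Characteristic
  open import Data.Nat as ℕ using (ℕ; zero; suc; NonZero; _+_; _∸_; _<_; _≤_; z≤n; s≤s; _≤ᵇ_; _≡ᵇ_)
  open import Data.Nat.Properties using (<-irrefl; <-trans; n<1+n; <-≤-trans; m+[n∸m]≡n; <⇒≤; m∸n≢0⇒n<m; 0≢1+n; m≤m+n;
    +-monoʳ-<; ≤-pred; pred[m∸n]≡m∸[1+n]; m∸n≡0⇒m≤n)
  open import Data.List as List using (List; []; _∷_; _++_; map; length; filterᵇ)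
  import Data.List.Properties as ListP
  open import Data.List.Relation.Unary.All as All using (All; []; _∷_)
  import Data.List.Relation.Unary.All.Properties as AllP
  import Data.List.Relation.Unary.Any.Properties as AnyP
  open import Data.List.Relation.Unary.Unique.Propositional using (Unique)
  open import Data.List.Relation.Unary.Unique.DecPropositional ℕ._≟_ using (unique?)
  open import Data.Product using (_×_; _,_; proj₁; proj₂)
  open import Data.Bool using (true; not)
  open import Data.Rational as ℚ using (ℚ; 0ℚ; _*_)
  open import Data.Rational.Properties using (*-assoc; *-zeroˡ; *-zeroʳ; *-identityˡ; +-identityˡ)
  open import Relation.Nullary using (does; yes; no; Dec)
  open import Relation.Binary.PropositionalEquality
  open import Data.Empty using (⊥-elim)

  private
    positionsNonZero-range : ∀ a k → 0 < a → All PositionNonZero (map colourless (range a k))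
    positionsNonZero-range a zero _ = []
    positionsNonZero-range a (suc k) 0<a = (λ e → <-irrefl (sym e) 0<a) ∷ positionsNonZero-range (suc a) k (<-trans 0<a (n<1+n a))

    colours-range : ∀ p a k → 0 < p → All (λ y → proj₁ y < p) (map colourless (range a k))
    colours-range p a zero _ = []
    colours-range p a (suc k) 0<p = 0<p ∷ colours-range p (suc a) k 0<p

    nonzero⇒true : (G : List (ℕ × ℕ)) → All PositionNonZero G → All (λ y → not (proj₂ y ≡ᵇ 0) ≡ true) G
    nonzero⇒true [] [] = []
    nonzero⇒true ((x , zero) ∷ G) (h ∷ hs) = ⊥-elim (h refl)
    nonzero⇒true ((x , suc m) ∷ G) (h ∷ hs) = refl ∷ nonzero⇒true G hs

  module _ {p n : ℕ} .{{_ : NonZero p}} .{{_ : NonZero n}} where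
    tailMatch : ℕ → Word p n → ℚ
    tailMatch a w = 𝟙⟨ does (trailing a w ≟ᴸ identityTail {p} {n} a) ⟩

    Σ-ψW-below : ∀ a → a ≤ n → (w : Word p n) → Σ< p (λ c → Σ< a (λ t → tailMatch a (ψW c t w))) ≡ ι (p ℕ.* a) * tailMatch a w
    Σ-ψW-below a a≤n w = begin
        Σ< p (λ c → Σ< a (λ t → tailMatch a (ψW c t w)))
      ≡⟨ Σ<-cong p (λ c _ → Σ<-cong a (λ t t<a → cong (λ X → 𝟙⟨ does (X ≟ᴸ identityTail {p} {n} a) ⟩)
           (trailing-ψW-below a c t (<-≤-trans t<a a≤n) t<a w))) ⟩
        Σ< p (λ c → Σ< a (λ t → tailMatch a w))
      ≡⟨ trans (Σ<-cong p (λ c _ → Σ<-const a (tailMatch a w))) (Σ<-const p _) ⟩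
        ι p * (ι a * tailMatch a w)
      ≡⟨ trans (sym (*-assoc (ι p) (ι a) _)) (cong (_* tailMatch a w) (sym (ι-* p a))) ⟩
        ι (p ℕ.* a) * tailMatch a w ∎
      where open ≡-Reasoning

    module _ (a M : ℕ) (n∸a≡1+M : n ∸ a ≡ suc M) (w : Word p n) where
      private
        G : List (ℕ × ℕ)
        G = filterᵇ (zeroOrAbove a) (νL w)
        V : List (ℕ × ℕ)
        V = map colourless (range (suc a) M)

        a+1+M≡n : a + suc M ≡ n
        a+1+M≡n = trans (cong (a +_) (sym n∸a≡1+M)) (m+[n∸m]≡n (<⇒≤ (m∸n≢0⇒n<m {n} {a} (λ z → 0≢1+n (trans (sym z) n∸a≡1+M)))))

        colours-G : All (λ y → proj₁ y < p) G
        colours-G = AllP.filter⁺ _ (All.map proj₁ (νL-bounds w))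

      trailing-ψW-as-insertion : ∀ c s → c < p → s ≤ M → tailMatch a (ψW c (a + s) w) ≡ 𝟙⟨ does (G ≟ᴸ insertAt s (c , 0) V) ⟩
      trailing-ψW-as-insertion c s c<p s≤M = begin
          𝟙⟨ does (trailing a (ψW c t w) ≟ᴸ identityTail {p} {n} a) ⟩
        ≡⟨ cong (λ X → 𝟙⟨ does (X ≟ᴸ identityTail {p} {n} a) ⟩) (trailing-ψW-above a c t t<n (m≤m+n a s) w) ⟩
          𝟙⟨ does (map (ψℕ p c t) G ≟ᴸ identityTail {p} {n} a) ⟩
        ≡⟨ cong (λ k → 𝟙⟨ does (map (ψℕ p c t) G ≟ᴸ map colourless (range a k)) ⟩) n∸a≡1+M ⟩
          𝟙⟨ does (map (ψℕ p c t) G ≟ᴸ map colourless (range a (suc M))) ⟩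
        ≡⟨ cong 𝟙⟨_⟩ (ψℕ-≟-φℕ p c t c<p G _ colours-G (colours-range p a (suc M) (ℕ.>-nonZero⁻¹ p))) ⟩
          𝟙⟨ does (G ≟ᴸ map (φℕ p c t) (map colourless (range a (suc M)))) ⟩
        ≡⟨ cong (λ X → 𝟙⟨ does (G ≟ᴸ X) ⟩) (φ-identityTail p c c<p a s M s≤M) ⟩
          𝟙⟨ does (G ≟ᴸ insertAt s (c , 0) V) ⟩ ∎
        where
        open ≡-Reasoning
        t : ℕ
        t = a + s
        t<n : t < n
        t<n = subst (t <_) a+1+M≡n (+-monoʳ-< a (s≤s s≤M))

      -- w is a permutation, so exactly one of its letters has position 0; removing it from G leaves trailing (suc a) w.
      splitAtZero : Unique (positions w) → ZeroSplit G (λ y → proj₁ y < p)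
      splitAtZero u = zeroSplit _ G (Unique-map-filterᵇ proj₂ (zeroOrAbove a) u) colours-G
        (Any-filterᵇ (zeroOrAbove a) (All-universal (νL w) (λ { (x , m) refl → refl }))
          (AnyP.map⁻ (Unique⇒Any≡0 n (positions w) u (AllP.map⁺ (All.map proj₂ (νL-bounds w)))
            (trans (ListP.length-map proj₂ (νL w)) (length-νL w)) (ℕ.>-nonZero⁻¹ n))))

      trailing-suc : (S : ZeroSplit G (λ y → proj₁ y < p)) → trailing (suc a) w ≡ ZeroSplit.G₁ S ++ ZeroSplit.G₂ S
      trailing-suc (mkZeroSplit G₁ G₂ d split nz₁ nz₂ _) = begin
          filterᵇ (λ y → suc a ≤ᵇ proj₂ y) (νL w)
        ≡⟨ sym (filter-nonzero-zeroOrAbove a (νL w)) ⟩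
          filterᵇ nonzero G
        ≡⟨ cong (filterᵇ nonzero) split ⟩
          filterᵇ nonzero (G₁ ++ (d , 0) ∷ G₂)
        ≡⟨ ListP.filter-++ _ G₁ ((d , 0) ∷ G₂) ⟩
          filterᵇ nonzero G₁ ++ filterᵇ nonzero G₂
        ≡⟨ cong₂ _++_ (filterᵇ-all _ G₁ (nonzero⇒true G₁ nz₁)) (filterᵇ-all _ G₂ (nonzero⇒true G₂ nz₂)) ⟩
          G₁ ++ G₂ ∎
        where
        open ≡-Reasoning
        nonzero : ℕ × ℕ → _
        nonzero y = not (proj₂ y ≡ᵇ 0)

      Σ-ψW-above : Unique (positions w) → Σ< p (λ c → Σ< (suc M) (λ s → tailMatch a (ψW c (a + s) w))) ≡ tailMatch (suc a) w
      Σ-ψW-above u with splitAtZero u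
      ... | S@(mkZeroSplit G₁ G₂ d split nz₁ _ d<p) = begin
          Σ< p (λ c → Σ< (suc M) (λ s → tailMatch a (ψW c (a + s) w)))
        ≡⟨ Σ<-cong p (λ c c<p → Σ<-cong (suc M) (λ s s<1+M → trailing-ψW-as-insertion c s c<p (≤-pred s<1+M))) ⟩
          Σ< p (λ c → Σ< (suc M) (λ s → 𝟙⟨ does (G ≟ᴸ insertAt s (c , 0) V) ⟩))
        ≡⟨ cong₂ (λ k X → Σ< p (λ c → Σ< (suc k) (λ s → 𝟙⟨ does (X ≟ᴸ insertAt s (c , 0) V) ⟩))) (sym length-V) split ⟩
          Σ< p (λ c → Σ< (suc (length V)) (λ s → 𝟙⟨ does ((G₁ ++ (d , 0) ∷ G₂) ≟ᴸ insertAt s (c , 0) V) ⟩))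
        ≡⟨ Σ-insertAt p d d<p G₁ G₂ V nz₁ (positionsNonZero-range (suc a) M (s≤s z≤n)) ⟩
          𝟙⟨ does ((G₁ ++ G₂) ≟ᴸ V) ⟩
        ≡⟨ cong₂ (λ X Y → 𝟙⟨ does (X ≟ᴸ Y) ⟩) (sym (trailing-suc S))
                 (cong (λ k → map colourless (range (suc a) k)) (trans (cong ℕ.pred (sym n∸a≡1+M)) (pred[m∸n]≡m∸[1+n] n a))) ⟩
          tailMatch (suc a) w ∎
        where
        open ≡-Reasoning
        length-V : length V ≡ M
        length-V = trans (ListP.length-map colourless (range (suc a) M)) (length-range (suc a) M)

    Σ-ψW-tailMatch : ∀ a → a ≤ n → (w : Word p n) → Unique (positions w) →
      Σ< p (λ c → Σ< n (λ t → tailMatch a (ψW c t w))) ≡ ι (p ℕ.* a) * tailMatch a w ℚ.+ 𝟙⟨ suc a ≤ᵇ n ⟩ * tailMatch (suc a) w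
    Σ-ψW-tailMatch a a≤n w u = begin
        Σ< p (λ c → Σ< n (λ t → tailMatch a (ψW c t w)))
      ≡⟨ Σ<-cong p (λ c _ → trans (cong (λ k → Σ< k (λ t → tailMatch a (ψW c t w))) (sym (m+[n∸m]≡n a≤n)))
                                   (Σ<-split a (n ∸ a) (λ t → tailMatch a (ψW c t w)))) ⟩
        Σ< p (λ c → Σ< a (λ t → tailMatch a (ψW c t w)) ℚ.+ Σ< (n ∸ a) (λ s → tailMatch a (ψW c (a + s) w)))
      ≡⟨ Σ<-+ p _ _ ⟩
        Σ< p (λ c → Σ< a (λ t → tailMatch a (ψW c t w))) ℚ.+ Σ< p (λ c → Σ< (n ∸ a) (λ s → tailMatch a (ψW c (a + s) w)))
      ≡⟨ cong₂ ℚ._+_ (Σ-ψW-below a a≤n w) (above (n ∸ a) refl) ⟩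
        ι (p ℕ.* a) * tailMatch a w ℚ.+ 𝟙⟨ suc a ≤ᵇ n ⟩ * tailMatch (suc a) w ∎
      where
      open ≡-Reasoning
      above : ∀ k → n ∸ a ≡ k → Σ< p (λ c → Σ< k (λ s → tailMatch a (ψW c (a + s) w))) ≡ 𝟙⟨ suc a ≤ᵇ n ⟩ * tailMatch (suc a) w
      above zero e = trans (Σ<-zero p) (sym (trans (cong (λ b → 𝟙⟨ b ⟩ * tailMatch (suc a) w) (>⇒≤ᵇ≡false {suc a} {n} (s≤s (m∸n≡0⇒m≤n {n} {a} e))))
                                                (*-zeroˡ (tailMatch (suc a) w))))
      above (suc M) e = trans (Σ-ψW-above a M e w u)
        (sym (trans (cong (λ b → 𝟙⟨ b ⟩ * tailMatch (suc a) w) (≤⇒≤ᵇ≡true (m∸n≢0⇒n<m {n} {a} (λ z → 0≢1+n (trans (sym z) e)))))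
                    (*-identityˡ (tailMatch (suc a) w))))

    Σ-ψW-β : ∀ a → a ≤ n → (w : Word p n) →
      Σ< p (λ c → Σ< n (λ t → β a (ψW c t w))) ≡ ι (p ℕ.* a) * β a w ℚ.+ 𝟙⟨ suc a ≤ᵇ n ⟩ * β (suc a) w
    Σ-ψW-β a a≤n w = trans factor (by-uniqueness (unique? (positions w)))
      where
      open ≡-Reasoning
      uniq : ℚ
      uniq = 𝟙⟨ does (unique? (positions w)) ⟩
      total : ℚ
      total = Σ< p (λ c → Σ< n (λ t → tailMatch a (ψW c t w)))
      factor : Σ< p (λ c → Σ< n (λ t → β a (ψW c t w))) ≡ uniq * total
      factor = begin
          Σ< p (λ c → Σ< n (λ t → β a (ψW c t w)))
        ≡⟨ Σ<-cong p (λ c _ → Σ<-cong n (λ t t<n → cong (λ b → 𝟙⟨ b ⟩ * tailMatch a (ψW c t w)) (unique-ψW c t t<n w))) ⟩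
          Σ< p (λ c → Σ< n (λ t → uniq * tailMatch a (ψW c t w)))
        ≡⟨ trans (Σ<-cong p (λ c _ → Σ<-*ˡ n uniq _)) (Σ<-*ˡ p uniq _) ⟩
          uniq * total ∎
      by-uniqueness : (d : Dec (Unique (positions w))) →
        𝟙⟨ does d ⟩ * total ≡ ι (p ℕ.* a) * (𝟙⟨ does d ⟩ * tailMatch a w) ℚ.+ 𝟙⟨ suc a ≤ᵇ n ⟩ * (𝟙⟨ does d ⟩ * tailMatch (suc a) w)
      by-uniqueness (no _) = trans (*-zeroˡ total) (sym (trans
        (cong₂ ℚ._+_ (trans (cong (ι (p ℕ.* a) *_) (*-zeroˡ (tailMatch a w))) (*-zeroʳ (ι (p ℕ.* a))))
                     (trans (cong (𝟙⟨ suc a ≤ᵇ n ⟩ *_) (*-zeroˡ (tailMatch (suc a) w))) (*-zeroʳ 𝟙⟨ suc a ≤ᵇ n ⟩)))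
        (+-identityˡ 0ℚ)))
      by-uniqueness (yes u) = trans (*-identityˡ total) (trans (Σ-ψW-tailMatch a a≤n w u)
        (sym (cong₂ ℚ._+_ (cong (ι (p ℕ.* a) *_) (*-identityˡ _)) (cong (𝟙⟨ suc a ≤ᵇ n ⟩ *_) (*-identityˡ _)))))

module ShuffleCount {A : Set} (_≟_ : DecidableEquality A) (P : A → Bool) where

  open Sums
  open ListFacts
  open import Data.Nat as ℕ using (suc)
  import Data.Nat.Properties as ℕP
  open import Data.Vec as Vec using (Vec; []; _∷_; toList)
  import Data.Vec.Properties as VecP
  open import Data.List as List using (List; []; _∷_; _++_; map; filterᵇ)
  import Data.List.Properties as ListP
  open import Data.List.Relation.Unary.All using (All; []; _∷_)
  open import Data.Product using (_×_; _,_)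
  open import Data.Bool using (Bool; true; false; not; _∧_)
  open import Data.Rational using (ℚ; 0ℚ; _+_; _*_)
  open import Data.Rational.Properties using (+-identityʳ; +-identityˡ; *-assoc; *-zeroˡ; *-zeroʳ)
  open import Data.Rational.Solver using (module +-*-Solver)
  open import Relation.Nullary using (does; ¬_)
  open import Relation.Nullary.Decidable using (_×-dec_)
  open import Relation.Binary.Definitions using (DecidableEquality)
  open import Relation.Binary.PropositionalEquality
  open +-*-Solver using (solve; _:*_; _:=_)

  _≟ᴸ_ : DecidableEquality (List A)
  _≟ᴸ_ = ListP.≡-dec _≟_

  private
    P̅ : A → Bool
    P̅ x = not (P x)

    split : List A → List A → List A → ℚ
    split V X Y = 𝟙⟨ does (filterᵇ P V ≟ᴸ X) ⟩ * 𝟙⟨ does (filterᵇ P̅ V ≟ᴸ Y) ⟩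

    𝟙-sym : ∀ (x y : A) → 𝟙⟨ does (x ≟ y) ⟩ ≡ 𝟙⟨ does (y ≟ x) ⟩
    𝟙-sym x y = cong 𝟙⟨_⟩ (does-⇔ (mk⇔ sym sym) (x ≟ y) (y ≟ x))

    P-true≢P-false : ∀ {x z} → P x ≡ true → P z ≡ false → ¬ (x ≡ z)
    P-true≢P-false px pz refl with () ← trans (sym px) pz

    not-true : ∀ Y → All (λ y → P y ≡ false) Y → All (λ y → P̅ y ≡ true) Y
    not-true [] [] = []
    not-true (y ∷ Y) (e ∷ es) = cong not e ∷ not-true Y es

    split-[] : ∀ {l} (ys : Vec A l) (V : List A) → All (λ y → P y ≡ false) (toList ys) → 𝟙⟨ does (toList ys ≟ᴸ V) ⟩ ≡ split V [] (toList ys)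
    split-[] ys V allF = trans (cong 𝟙⟨_⟩ (does-⇔ (mk⇔ to from) (toList ys ≟ᴸ V) ((filterᵇ P V ≟ᴸ []) ×-dec (filterᵇ P̅ V ≟ᴸ toList ys))))
                                (𝟙-∧ (does (filterᵇ P V ≟ᴸ [])) _)
      where
      to : toList ys ≡ V → filterᵇ P V ≡ [] × filterᵇ P̅ V ≡ toList ys
      to refl = filterᵇ-none P (toList ys) allF , filterᵇ-all P̅ (toList ys) (not-true _ allF)
      from : filterᵇ P V ≡ [] × filterᵇ P̅ V ≡ toList ys → toList ys ≡ V
      from (e₁ , e₂) = trans (sym e₂) (filterᵇ-all P̅ V (not-true V (filterᵇ≡[]⇒none P V e₁)))

    split-head-P : ∀ z V x X Y → P z ≡ true → split (z ∷ V) (x ∷ X) Y ≡ 𝟙⟨ does (x ≟ z) ⟩ * split V X Y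
    split-head-P z V x X Y e = begin
        𝟙⟨ does (filterᵇ P (z ∷ V) ≟ᴸ (x ∷ X)) ⟩ * 𝟙⟨ does (filterᵇ P̅ (z ∷ V) ≟ᴸ Y) ⟩
      ≡⟨ cong₂ (λ F G → 𝟙⟨ does (F ≟ᴸ (x ∷ X)) ⟩ * 𝟙⟨ does (G ≟ᴸ Y) ⟩) (filterᵇ-accept P e) (filterᵇ-reject P̅ (cong not e)) ⟩
        𝟙⟨ does (z ≟ x) ∧ does (filterᵇ P V ≟ᴸ X) ⟩ * b
      ≡⟨ cong (_* b) (trans (𝟙-∧ (does (z ≟ x)) _) (cong (_* a) (𝟙-sym z x))) ⟩
        𝟙⟨ does (x ≟ z) ⟩ * a * b
      ≡⟨ *-assoc 𝟙⟨ does (x ≟ z) ⟩ a b ⟩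
        𝟙⟨ does (x ≟ z) ⟩ * split V X Y ∎
      where
      open ≡-Reasoning
      a b : ℚ
      a = 𝟙⟨ does (filterᵇ P V ≟ᴸ X) ⟩
      b = 𝟙⟨ does (filterᵇ P̅ V ≟ᴸ Y) ⟩

    split-head-P̅ : ∀ z V X y Y → P z ≡ false → split (z ∷ V) X (y ∷ Y) ≡ 𝟙⟨ does (y ≟ z) ⟩ * split V X Y
    split-head-P̅ z V X y Y e = begin
        𝟙⟨ does (filterᵇ P (z ∷ V) ≟ᴸ X) ⟩ * 𝟙⟨ does (filterᵇ P̅ (z ∷ V) ≟ᴸ (y ∷ Y)) ⟩
      ≡⟨ cong₂ (λ F G → 𝟙⟨ does (F ≟ᴸ X) ⟩ * 𝟙⟨ does (G ≟ᴸ (y ∷ Y)) ⟩) (filterᵇ-reject P e) (filterᵇ-accept P̅ (cong not e)) ⟩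
        a * 𝟙⟨ does (z ≟ y) ∧ does (filterᵇ P̅ V ≟ᴸ Y) ⟩
      ≡⟨ cong (a *_) (trans (𝟙-∧ (does (z ≟ y)) _) (cong (_* b) (𝟙-sym z y))) ⟩
        a * (𝟙⟨ does (y ≟ z) ⟩ * b)
      ≡⟨ solve 3 (λ a b c → a :* (b :* c) := b :* (a :* c)) refl a 𝟙⟨ does (y ≟ z) ⟩ b ⟩
        𝟙⟨ does (y ≟ z) ⟩ * split V X Y ∎
      where
      open ≡-Reasoning
      a b : ℚ
      a = 𝟙⟨ does (filterᵇ P V ≟ᴸ X) ⟩
      b = 𝟙⟨ does (filterᵇ P̅ V ≟ᴸ Y) ⟩

    split-∷ : ∀ x y z X Y V → P x ≡ true → P y ≡ false →
      𝟙⟨ does (x ≟ z) ⟩ * split V X (y ∷ Y) + 𝟙⟨ does (y ≟ z) ⟩ * split V (x ∷ X) Y ≡ split (z ∷ V) (x ∷ X) (y ∷ Y)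
    split-∷ x y z X Y V px py = by-P (P z) refl
      where
      S₁ S₂ : ℚ
      S₁ = split V X (y ∷ Y)
      S₂ = split V (x ∷ X) Y
      by-P : (b : Bool) → P z ≡ b → 𝟙⟨ does (x ≟ z) ⟩ * S₁ + 𝟙⟨ does (y ≟ z) ⟩ * S₂ ≡ split (z ∷ V) (x ∷ X) (y ∷ Y)
      by-P true e = begin
          𝟙⟨ does (x ≟ z) ⟩ * S₁ + 𝟙⟨ does (y ≟ z) ⟩ * S₂
        ≡⟨ cong (λ q → 𝟙⟨ does (x ≟ z) ⟩ * S₁ + q * S₂) (𝟙-no (y ≟ z) (λ y≡z → P-true≢P-false e py (sym y≡z))) ⟩
          𝟙⟨ does (x ≟ z) ⟩ * S₁ + 0ℚ * S₂
        ≡⟨ trans (cong (𝟙⟨ does (x ≟ z) ⟩ * S₁ +_) (*-zeroˡ S₂)) (+-identityʳ _) ⟩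
          𝟙⟨ does (x ≟ z) ⟩ * S₁
        ≡⟨ sym (split-head-P z V x X (y ∷ Y) e) ⟩
          split (z ∷ V) (x ∷ X) (y ∷ Y) ∎
        where open ≡-Reasoning
      by-P false e = begin
          𝟙⟨ does (x ≟ z) ⟩ * S₁ + 𝟙⟨ does (y ≟ z) ⟩ * S₂
        ≡⟨ cong (λ q → q * S₁ + 𝟙⟨ does (y ≟ z) ⟩ * S₂) (𝟙-no (x ≟ z) (P-true≢P-false px e)) ⟩
          0ℚ * S₁ + 𝟙⟨ does (y ≟ z) ⟩ * S₂
        ≡⟨ trans (cong (_+ 𝟙⟨ does (y ≟ z) ⟩ * S₂) (*-zeroˡ S₁)) (+-identityˡ _) ⟩
          𝟙⟨ does (y ≟ z) ⟩ * S₂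
        ≡⟨ sym (split-head-P̅ z V (x ∷ X) y Y e) ⟩
          split (z ∷ V) (x ∷ X) (y ∷ Y) ∎
        where open ≡-Reasoning

    split-∷-[] : ∀ x z X V → P x ≡ true → 𝟙⟨ does (x ≟ z) ⟩ * split V X [] ≡ split (z ∷ V) (x ∷ X) []
    split-∷-[] x z X V px = by-P (P z) refl
      where
      by-P : (b : Bool) → P z ≡ b → 𝟙⟨ does (x ≟ z) ⟩ * split V X [] ≡ split (z ∷ V) (x ∷ X) []
      by-P true e = sym (split-head-P z V x X [] e)
      by-P false e = trans (cong (_* split V X []) (𝟙-no (x ≟ z) (P-true≢P-false px e))) (trans (*-zeroˡ (split V X []))
        (sym (trans (cong (λ G → 𝟙⟨ does (filterᵇ P (z ∷ V) ≟ᴸ (x ∷ X)) ⟩ * 𝟙⟨ does (G ≟ᴸ []) ⟩) (filterᵇ-accept P̅ (cong not e)))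
                    (*-zeroʳ 𝟙⟨ does (filterᵇ P (z ∷ V) ≟ᴸ (x ∷ X)) ⟩))))

  Σ-shuffle : ∀ {m l} (xs : Vec A m) (ys : Vec A l) (V : List A) →
    All (λ x → P x ≡ true) (toList xs) → All (λ y → P y ≡ false) (toList ys) →
    ΣL (shuffle xs ys) (λ u → 𝟙⟨ does (toList u ≟ᴸ V) ⟩) ≡ 𝟙⟨ does (filterᵇ P V ≟ᴸ toList xs) ⟩ * 𝟙⟨ does (filterᵇ P̅ V ≟ᴸ toList ys) ⟩
  Σ-shuffle [] ys V _ allF = trans (+-identityʳ _) (split-[] ys V allF)
  Σ-shuffle (x ∷ xs) [] [] _ [] =
    trans (ΣL-map (x ∷_) (shuffle xs []) _) (trans (ΣL-zero (shuffle xs [])) (sym (*-zeroˡ 𝟙⟨ does (filterᵇ P̅ [] ≟ᴸ []) ⟩)))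
  Σ-shuffle (x ∷ xs) [] (z ∷ V) (px ∷ allT) [] = begin
      ΣL (map (x ∷_) (shuffle xs [])) (λ u → 𝟙⟨ does (toList u ≟ᴸ (z ∷ V)) ⟩)
    ≡⟨ trans (ΣL-map (x ∷_) (shuffle xs []) _) (ΣL-cong (shuffle xs []) (λ u → 𝟙-∧ (does (x ≟ z)) _)) ⟩
      ΣL (shuffle xs []) (λ u → 𝟙⟨ does (x ≟ z) ⟩ * 𝟙⟨ does (toList u ≟ᴸ V) ⟩)
    ≡⟨ trans (ΣL-*ˡ (shuffle xs []) 𝟙⟨ does (x ≟ z) ⟩ _) (cong (𝟙⟨ does (x ≟ z) ⟩ *_) (Σ-shuffle xs [] V allT [])) ⟩
      𝟙⟨ does (x ≟ z) ⟩ * split V (toList xs) []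
    ≡⟨ split-∷-[] x z (toList xs) V px ⟩
      split (z ∷ V) (x ∷ toList xs) [] ∎
    where open ≡-Reasoning
  Σ-shuffle {suc m} {suc l} (x ∷ xs) (y ∷ ys) V (px ∷ allT) (py ∷ allF) = begin
      ΣL (map (x ∷_) S₁ ++ map (λ v → Vec.cast eq (y ∷ v)) S₂) f
    ≡⟨ ΣL-++ (map (x ∷_) S₁) _ f ⟩
      ΣL (map (x ∷_) S₁) f + ΣL (map (λ v → Vec.cast eq (y ∷ v)) S₂) f
    ≡⟨ cong₂ _+_ (ΣL-map (x ∷_) S₁ f) (trans (ΣL-map _ S₂ f) (ΣL-cong S₂ (λ u → cong (λ L → 𝟙⟨ does (L ≟ᴸ V) ⟩) (VecP.toList-cast eq (y ∷ u))))) ⟩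
      ΣL S₁ (λ u → 𝟙⟨ does ((x ∷ toList u) ≟ᴸ V) ⟩) + ΣL S₂ (λ u → 𝟙⟨ does ((y ∷ toList u) ≟ᴸ V) ⟩)
    ≡⟨ by-first-letter V ⟩
      split V (x ∷ toList xs) (y ∷ toList ys) ∎
    where
    open ≡-Reasoning
    S₁ : List (Vec A (m ℕ.+ suc l))
    S₁ = shuffle xs (y ∷ ys)
    S₂ : List (Vec A (suc m ℕ.+ l))
    S₂ = shuffle (x ∷ xs) ys
    eq : suc (suc m ℕ.+ l) ≡ suc m ℕ.+ suc l
    eq = sym (ℕP.+-suc (suc m) l)
    f : Vec A _ → ℚ
    f u = 𝟙⟨ does (toList u ≟ᴸ V) ⟩
    by-first-letter : ∀ V → ΣL S₁ (λ u → 𝟙⟨ does ((x ∷ toList u) ≟ᴸ V) ⟩) + ΣL S₂ (λ u → 𝟙⟨ does ((y ∷ toList u) ≟ᴸ V) ⟩)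
                          ≡ split V (x ∷ toList xs) (y ∷ toList ys)
    by-first-letter [] = trans (cong₂ _+_ (ΣL-zero S₁) (ΣL-zero S₂)) (trans (+-identityˡ 0ℚ) (sym (*-zeroˡ 𝟙⟨ does ([] ≟ᴸ (y ∷ toList ys)) ⟩)))
    by-first-letter (z ∷ V′) = trans (cong₂ _+_
        (trans (ΣL-cong S₁ (λ u → 𝟙-∧ (does (x ≟ z)) _))
          (trans (ΣL-*ˡ S₁ 𝟙⟨ does (x ≟ z) ⟩ _) (cong (𝟙⟨ does (x ≟ z) ⟩ *_) (Σ-shuffle xs (y ∷ ys) V′ allT (py ∷ allF)))))
        (trans (ΣL-cong S₂ (λ u → 𝟙-∧ (does (y ≟ z)) _))
          (trans (ΣL-*ˡ S₂ 𝟙⟨ does (y ≟ z) ⟩ _) (cong (𝟙⟨ does (y ≟ z) ⟩ *_) (Σ-shuffle (x ∷ xs) ys V′ (px ∷ allT) allF)))))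
      (split-∷ x y z (toList xs) (toList ys) V′ px py)

module BCoefficients where

  open Sums
  open Coefficients
  open Enumeration
  open Insertion using (ν; ν-injective; toℕ-𝟎)
  open ListFacts
  open InsertionCount using (_≟ᴸ_)
  open Characteristic
  open import Data.Nat as ℕ using (ℕ; zero; suc; NonZero; _∸_; _<_; _≤_; _<ᵇ_; _≡ᵇ_)
  import Data.Nat.Properties as ℕP
  open import Data.Fin as Fin using (Fin; toℕ; _↑ˡ_; _↑ʳ_)
  open import Data.Fin.Properties using (toℕ<n; toℕ-injective; toℕ-↑ʳ; toℕ-↑ˡ; toℕ-fromℕ<) renaming (_≟_ to _≟ᶠ_)
  open import Data.Vec as Vec using (Vec; []; _∷_; toList; tabulate)
  import Data.Vec.Properties as VecP
  open import Data.List as List using (List; []; _∷_; map; length; filterᵇ)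
  import Data.List.Properties as ListP
  open import Data.List.Relation.Unary.All as All using (All; []; _∷_)
  open import Data.List.Relation.Unary.AllPairs using ([]; _∷_)
  open import Data.List.Relation.Unary.Unique.Propositional using (Unique)
  import Data.List.Relation.Unary.Unique.Propositional.Properties as UniqueP
  open import Data.List.Relation.Unary.Unique.DecPropositional ℕ._≟_ using (unique?)
  import Data.List.Relation.Unary.Unique.DecPropositional as UniqueDec
  open import Data.Product using (_×_; _,_; proj₁; proj₂)
  open import Data.Bool using (Bool; true; false; not; _∧_; if_then_else_)
  open import Data.Rational using (ℚ; 0ℚ; 1ℚ; _+_; _*_)
  open import Data.Rational.Properties
  open import Relation.Nullary using (does; yes; no; Dec)
  open import Relation.Nullary.Decidable using (_×-dec_)
  open import Relation.Binary.PropositionalEquality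
  open import Function using (_∘_)

  Unique-range : ∀ a k → Unique (range a k)
  Unique-range a zero = []
  Unique-range a (suc k) = above (suc a) k (ℕP.n<1+n a) ∷ Unique-range (suc a) k
    where
    above : ∀ b k → a < b → All (a ≢_) (range b k)
    above b zero _ = []
    above b (suc k) a<b = (λ e → ℕP.<-irrefl e a<b) ∷ above (suc b) k (ℕP.<-trans a<b (ℕP.n<1+n b))

  positions-colourless-range : ∀ a k → map proj₂ (map colourless (range a k)) ≡ range a k
  positions-colourless-range a k = trans (sym (ListP.map-∘ (range a k))) (ListP.map-id (range a k))

  νL-injective : ∀ {p n} {v w : Word p n} → νL v ≡ νL w → v ≡ w
  νL-injective {v = v} {w} e = trans (sym (VecP.cast-is-id refl v)) (VecP.toList-injective refl v w (ListP.map-injective ν-injective e))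

  νL-tabulate : ∀ {p n k} (b : ℕ) (g : Fin k → Letter p n) → (∀ i → ν (g i) ≡ (0 , b ℕ.+ toℕ i)) →
    map ν (toList (tabulate g)) ≡ map colourless (range b k)
  νL-tabulate {k = zero} b g h = refl
  νL-tabulate {k = suc k} b g h = cong₂ _∷_ (trans (h Fin.zero) (cong (0 ,_) (ℕP.+-identityʳ b)))
    (νL-tabulate (suc b) (g ∘ Fin.suc) (λ i → trans (h (Fin.suc i)) (cong (0 ,_) (ℕP.+-suc b (toℕ i)))))

  coeff-B₀ : ∀ {p n} .{{_ : NonZero p}} (w : Word p n) → coeff (B p n 0) w ≡ β 0 w
  coeff-B₀ {p} {n} w = begin
      (if does (idW ≟ʷ w) then 1ℚ + 0ℚ else 0ℚ)
    ≡⟨ unit (does (idW ≟ʷ w)) ⟩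
      𝟙⟨ does (idW ≟ʷ w) ⟩
    ≡⟨ cong 𝟙⟨_⟩ (does-⇔ (mk⇔ to from) (idW ≟ʷ w) (unique? (positions w) ×-dec (trailing 0 w ≟ᴸ identityTail {p} {n} 0))) ⟩
      𝟙⟨ does (unique? (positions w)) ∧ does (trailing 0 w ≟ᴸ identityTail {p} {n} 0) ⟩
    ≡⟨ 𝟙-∧ (does (unique? (positions w))) _ ⟩
      β 0 w ∎
    where
    open ≡-Reasoning
    unit : ∀ b → (if b then 1ℚ + 0ℚ else 0ℚ) ≡ 𝟙⟨ b ⟩
    unit true = +-identityʳ 1ℚ
    unit false = refl
    trailing-0 : ∀ v → trailing 0 v ≡ νL v
    trailing-0 v = filterᵇ-all _ (νL v) (All-universal (νL v) (λ _ → refl))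
    νL-idW : νL (idW {p} {n}) ≡ map colourless (range 0 n)
    νL-idW = νL-tabulate 0 (λ i → (𝟎 {p} , i)) (λ i → cong (_, toℕ i) toℕ-𝟎)
    to : idW ≡ w → Unique (positions w) × trailing 0 w ≡ identityTail {p} {n} 0
    to refl = subst Unique (sym (trans (cong (map proj₂) νL-idW) (positions-colourless-range 0 n))) (Unique-range 0 n)
            , trans (trailing-0 idW) νL-idW
    from : Unique (positions w) × trailing 0 w ≡ identityTail {p} {n} 0 → idW ≡ w
    from (_ , e) = νL-injective (trans νL-idW (trans (sym e) (trailing-0 w)))

  distinctPositions : ∀ {p k} → Word p k → Bool
  distinctPositions {p} {k} α = does (UniqueDec.unique? (_≟ᶠ_ {k}) (toList (Vec.map proj₂ α)))

  distinctPositions≡ : ∀ {p n} (w : Word p n) → distinctPositions w ≡ does (unique? (positions w))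
  distinctPositions≡ {p} {n} w = does-⇔ (mk⇔ (λ u → subst Unique (sym positions≡) (UniqueP.map⁺ toℕ-injective u))
    (λ u → UniqueP.map⁻ (subst Unique positions≡ u))) (UniqueDec.unique? (_≟ᶠ_ {n}) (toList (Vec.map proj₂ w))) (unique? (positions w))
    where
    positions≡ : positions w ≡ map toℕ (toList (Vec.map proj₂ w))
    positions≡ = trans (sym (ListP.map-∘ (toList w))) (trans (ListP.map-∘ (toList w)) (cong (map toℕ) (sym (VecP.toList-map proj₂ w))))

  coeff-elems : ∀ {p n} (w : Word p n) → coeff (map (λ α → (1ℚ , α)) (elems p n)) w ≡ 𝟙⟨ distinctPositions w ⟩
  coeff-elems {p} {n} w = begin
      coeff (map (λ α → (1ℚ , α)) (elems p n)) w
    ≡⟨ coeff-map-unit (λ α → α) (elems p n) w ⟩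
      ΣL (elems p n) (λ α → 𝟙⟨ does (α ≟ʷ w) ⟩)
    ≡⟨ ΣL-filter _ (allWords p n) _ ⟩
      ΣL (allWords p n) (λ α → 𝟙⟨ distinctPositions α ⟩ * 𝟙⟨ does (α ≟ʷ w) ⟩)
    ≡⟨ ΣL-cong (allWords p n) (λ α → *-comm 𝟙⟨ distinctPositions α ⟩ _) ⟩
      ΣL (allWords p n) (λ α → 𝟙⟨ does (α ≟ʷ w) ⟩ * 𝟙⟨ distinctPositions α ⟩)
    ≡⟨ IsEnumeration-allWords p n w (λ α → 𝟙⟨ distinctPositions α ⟩) ⟩
      𝟙⟨ distinctPositions w ⟩ ∎
    where open ≡-Reasoning

  module Shuffled (p a m : ℕ) .{{_ : NonZero p}} where
    private
      N : ℕ
      N = a ℕ.+ m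

      lift : Letter p a → Letter p N
      lift l = (proj₁ l , proj₂ l ↑ˡ m)

      W : Vec (Letter p N) m
      W = tabulate (λ i → (𝟎 {p} , a ↑ʳ i))

      pos : {k : ℕ} → Letter p k → ℕ
      pos l = toℕ (proj₂ l)

      early : Letter p N → Bool
      early l = pos l <ᵇ a

    open ShuffleCount (_≟ˡ_ {p} {N}) early using (Σ-shuffle) renaming (_≟ᴸ_ to _≟ᵂ_)

    private
      unlift : (y : Letter p N) → pos y < a → Letter p a
      unlift (c , j) pf = (c , Fin.fromℕ< pf)

      lift-unlift : ∀ y pf → lift (unlift y pf) ≡ y
      lift-unlift (c , j) pf = cong (c ,_) (toℕ-injective (trans (toℕ-↑ˡ (Fin.fromℕ< pf) m) (toℕ-fromℕ< pf)))

      unlift-lift : ∀ x pf → unlift (lift x) pf ≡ x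
      unlift-lift (c , j) pf = cong (c ,_) (toℕ-injective (trans (toℕ-fromℕ< pf) (toℕ-↑ˡ j m)))

      Σ-Letters-lift : (y : Letter p N) → pos y < a → ΣL (Letters p a) (λ x → 𝟙⟨ does (y ≟ˡ lift x) ⟩) ≡ 1ℚ
      Σ-Letters-lift y pf = trans (ΣL-cong (Letters p a) (λ x → trans (cong 𝟙⟨_⟩ (does-⇔ (mk⇔ (to x) (from x)) (y ≟ˡ lift x) (x ≟ˡ unlift y pf)))
          (sym (*-identityʳ _)))) (IsEnumeration-Letters p a (unlift y pf) (λ _ → 1ℚ))
        where
        to : ∀ x → y ≡ lift x → x ≡ unlift y pf
        to x refl = sym (unlift-lift x pf)
        from : ∀ x → x ≡ unlift y pf → y ≡ lift x
        from x refl = sym (lift-unlift y pf)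

      Σ-allVec-lift : (X : List (Letter p N)) → All (λ y → pos y < a) X → ∀ k →
        ΣL (allVec (Letters p a) k) (λ α → 𝟙⟨ does (X ≟ᵂ toList (Vec.map lift α)) ⟩) ≡ 𝟙⟨ length X ≡ᵇ k ⟩
      Σ-allVec-lift [] [] zero = +-identityʳ 1ℚ
      Σ-allVec-lift (y ∷ X) _ zero = +-identityʳ 0ℚ
      Σ-allVec-lift [] [] (suc k) = trans (ΣL-concatMap-map _∷_ (Letters p a) (allVec (Letters p a) k) _)
        (trans (ΣL-cong (Letters p a) (λ x → ΣL-zero (allVec (Letters p a) k))) (ΣL-zero (Letters p a)))
      Σ-allVec-lift (y ∷ X) (py ∷ pX) (suc k) = begin
          ΣL (allVec (Letters p a) (suc k)) (λ α → 𝟙⟨ does ((y ∷ X) ≟ᵂ toList (Vec.map lift α)) ⟩)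
        ≡⟨ ΣL-concatMap-map _∷_ (Letters p a) (allVec (Letters p a) k) _ ⟩
          ΣL (Letters p a) (λ x → ΣL (allVec (Letters p a) k) (λ α → 𝟙⟨ does (y ≟ˡ lift x) ∧ does (X ≟ᵂ toList (Vec.map lift α)) ⟩))
        ≡⟨ ΣL-cong (Letters p a) (λ x → trans (ΣL-cong (allVec (Letters p a) k) (λ α → 𝟙-∧ (does (y ≟ˡ lift x)) _))
             (trans (ΣL-*ˡ (allVec (Letters p a) k) 𝟙⟨ does (y ≟ˡ lift x) ⟩ _) (cong (𝟙⟨ does (y ≟ˡ lift x) ⟩ *_) (Σ-allVec-lift X pX k)))) ⟩
          ΣL (Letters p a) (λ x → 𝟙⟨ does (y ≟ˡ lift x) ⟩ * 𝟙⟨ length X ≡ᵇ k ⟩)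
        ≡⟨ trans (ΣL-cong (Letters p a) (λ x → *-comm _ 𝟙⟨ length X ≡ᵇ k ⟩)) (ΣL-*ˡ (Letters p a) 𝟙⟨ length X ≡ᵇ k ⟩ _) ⟩
          𝟙⟨ length X ≡ᵇ k ⟩ * ΣL (Letters p a) (λ x → 𝟙⟨ does (y ≟ˡ lift x) ⟩)
        ≡⟨ trans (cong (𝟙⟨ length X ≡ᵇ k ⟩ *_) (Σ-Letters-lift y py)) (*-identityʳ _) ⟩
          𝟙⟨ length X ≡ᵇ k ⟩ ∎
        where
        open ≡-Reasoning

      positions≡ : ∀ {k} (w : Word p k) → positions w ≡ map pos (toList w)
      positions≡ w = sym (ListP.map-∘ (toList w))

      pos-lift : ∀ {k} (α : Vec (Letter p a) k) → map pos (toList (Vec.map lift α)) ≡ map pos (toList α)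
      pos-lift [] = refl
      pos-lift ((c , j) ∷ α) = cong₂ _∷_ (toℕ-↑ˡ j m) (pos-lift α)

      early-lift : ∀ {k} (α : Vec (Letter p a) k) → All (λ x → early x ≡ true) (toList (Vec.map lift α))
      early-lift [] = []
      early-lift ((c , j) ∷ α) = <⇒<ᵇ≡true (subst (_< a) (sym (toℕ-↑ˡ j m)) (toℕ<n j)) ∷ early-lift α

      early-pos : ∀ (X : List (Letter p N)) → All (λ y → pos y < a) (filterᵇ early X)
      early-pos [] = []
      early-pos (x ∷ X) with early x in e
      ... | true = <ᵇ≡true⇒< e ∷ early-pos X
      ... | false = early-pos X

      νL-W : map ν (toList W) ≡ map colourless (range a m)
      νL-W = νL-tabulate a (λ i → (𝟎 {p} , a ↑ʳ i)) (λ i → cong₂ _,_ toℕ-𝟎 (toℕ-↑ʳ a i))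

      late-W : All (λ x → early x ≡ false) (toList W)
      late-W = late (toList W) (subst (All (λ y → a ≤ proj₂ y)) (sym νL-W) (above a m ℕP.≤-refl))
        where
        above : ∀ b k → a ≤ b → All (λ y → a ≤ proj₂ y) (map colourless (range b k))
        above b zero _ = []
        above b (suc k) a≤b = a≤b ∷ above (suc b) k (ℕP.m≤n⇒m≤1+n a≤b)
        late : ∀ L → All (λ y → a ≤ proj₂ y) (map ν L) → All (λ x → early x ≡ false) L
        late [] [] = []
        late (l ∷ L) (h ∷ hs) = ≥⇒<ᵇ≡false h ∷ late L hs

    module _ (v : Word p N) where
      private
        V X Z : List (Letter p N)
        V = toList v
        X = filterᵇ early V
        Z = filterᵇ (not ∘ early) V

        E : ℚ
        E = 𝟙⟨ does (Z ≟ᵂ toList W) ⟩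

        uX : Bool
        uX = does (unique? (map pos X))

        coeff-shuffle-lift : ∀ α → coeff (map (λ u → (1ℚ , u)) (shuffle (Vec.map lift α) W)) v ≡ 𝟙⟨ does (X ≟ᵂ toList (Vec.map lift α)) ⟩ * E
        coeff-shuffle-lift α = trans (coeff-map-unit (λ u → u) (shuffle (Vec.map lift α) W) v)
          (trans (ΣL-cong (shuffle (Vec.map lift α) W) (λ u → cong 𝟙⟨_⟩ (does-⇔ (mk⇔ (cong toList) (toList⇒≡ u)) (u ≟ʷ v) (toList u ≟ᵂ V))))
                 (Σ-shuffle (Vec.map lift α) W V (early-lift α) late-W))
          where
          toList⇒≡ : ∀ u → toList u ≡ V → u ≡ v
          toList⇒≡ u e = trans (sym (VecP.cast-is-id refl u)) (VecP.toList-injective refl u v e)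

        Σ-elems-lift : ΣL (elems p a) (λ α → 𝟙⟨ does (X ≟ᵂ toList (Vec.map lift α)) ⟩) ≡ 𝟙⟨ uX ⟩ * 𝟙⟨ length X ≡ᵇ a ⟩
        Σ-elems-lift = begin
            ΣL (elems p a) (λ α → 𝟙⟨ does (X ≟ᵂ toList (Vec.map lift α)) ⟩)
          ≡⟨ ΣL-filter _ (allWords p a) _ ⟩
            ΣL (allWords p a) (λ α → 𝟙⟨ distinctPositions α ⟩ * 𝟙⟨ does (X ≟ᵂ toList (Vec.map lift α)) ⟩)
          ≡⟨ trans (ΣL-cong (allWords p a) distinct⇔uX) (ΣL-*ˡ (allWords p a) 𝟙⟨ uX ⟩ _) ⟩
            𝟙⟨ uX ⟩ * ΣL (allWords p a) (λ α → 𝟙⟨ does (X ≟ᵂ toList (Vec.map lift α)) ⟩)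
          ≡⟨ cong (𝟙⟨ uX ⟩ *_) (Σ-allVec-lift X (early-pos V) a) ⟩
            𝟙⟨ uX ⟩ * 𝟙⟨ length X ≡ᵇ a ⟩ ∎
          where
          open ≡-Reasoning
          distinct⇔uX : ∀ α → 𝟙⟨ distinctPositions α ⟩ * 𝟙⟨ does (X ≟ᵂ toList (Vec.map lift α)) ⟩ ≡ 𝟙⟨ uX ⟩ * 𝟙⟨ does (X ≟ᵂ toList (Vec.map lift α)) ⟩
          distinct⇔uX α with X ≟ᵂ toList (Vec.map lift α)
          ... | no _ = trans (*-zeroʳ 𝟙⟨ distinctPositions α ⟩) (sym (*-zeroʳ 𝟙⟨ uX ⟩))
          ... | yes e = cong (λ b → 𝟙⟨ b ⟩ * 1ℚ) (trans (distinctPositions≡ α)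
              (cong (λ L → does (unique? L)) (trans (positions≡ α) (trans (sym (pos-lift α)) (cong (map pos) (sym e))))))

        trailing≡ : trailing a v ≡ map ν Z
        trailing≡ = trans (filterᵇ-map _ ν V) (cong (map ν) (filterᵇ-cong _ _ V (All-universal V (λ l → ≤ᵇ≡not<ᵇ a (pos l)))))

        identityTail≡ : identityTail {p} {N} a ≡ map ν (toList W)
        identityTail≡ = trans (cong (λ k → map colourless (range a k)) (ℕP.m+n∸m≡n a m)) (sym νL-W)

        Z≡W⇔ : (Z ≡ toList W) ⇔ (trailing a v ≡ identityTail {p} {N} a)
        Z≡W⇔ = mk⇔ (λ e → trans trailing≡ (trans (cong (map ν) e) (sym identityTail≡)))
                   (λ e → ListP.map-injective ν-injective (trans (sym trailing≡) (trans e identityTail≡)))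

        -- When the late letters are exactly W, the early ones number a, and they are distinct iff all letters are.
        β-from-parts : E * (𝟙⟨ uX ⟩ * 𝟙⟨ length X ≡ᵇ a ⟩) ≡ β a v
        β-from-parts = trans (cong (λ b → 𝟙⟨ b ⟩ * (𝟙⟨ uX ⟩ * 𝟙⟨ length X ≡ᵇ a ⟩)) (does-⇔ Z≡W⇔ (Z ≟ᵂ toList W) (trailing a v ≟ᴸ identityTail {p} {N} a)))
                             (by-tail (trailing a v ≟ᴸ identityTail {p} {N} a))
          where
          by-tail : (d : Dec (trailing a v ≡ identityTail {p} {N} a)) → 𝟙⟨ does d ⟩ * (𝟙⟨ uX ⟩ * 𝟙⟨ length X ≡ᵇ a ⟩) ≡ 𝟙⟨ does (unique? (positions v)) ⟩ * 𝟙⟨ does d ⟩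
          by-tail (no _) = trans (*-zeroˡ (𝟙⟨ uX ⟩ * 𝟙⟨ length X ≡ᵇ a ⟩)) (sym (*-zeroʳ 𝟙⟨ does (unique? (positions v)) ⟩))
          by-tail (yes e) = trans (*-identityˡ _) (trans (cong (λ b → 𝟙⟨ uX ⟩ * 𝟙⟨ b ⟩) (trans (cong (_≡ᵇ a) length-X) (≡ᵇ-refl a)))
              (trans (*-identityʳ _) (trans (cong 𝟙⟨_⟩ uX≡) (sym (*-identityʳ _)))))
            where
            Z≡W : Z ≡ toList W
            Z≡W = Equivalence.from Z≡W⇔ e
            length-X : length X ≡ a
            length-X = ℕP.+-cancelʳ-≡ m (length X) a (trans (cong (length X ℕ.+_) (sym (trans (cong length Z≡W) (VecP.length-toList W))))
                         (trans (length-filterᵇ-not early V) (VecP.length-toList v)))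
            Unique-Z : Unique (map pos Z)
            Unique-Z = subst Unique (sym (trans (cong (map pos) Z≡W) (trans (ListP.map-∘ (toList W))
                          (trans (cong (map proj₂) νL-W) (positions-colourless-range a m))))) (Unique-range a m)
            uX≡ : uX ≡ does (unique? (positions v))
            uX≡ = does-⇔ (mk⇔ (λ u → subst Unique (sym (positions≡ v)) (Unique-map-partition pos a V u Unique-Z))
                         (λ u → Unique-map-filterᵇ pos early (subst Unique (positions≡ v) u))) (unique? (map pos X)) (unique? (positions v))

      coeff-Bsh : coeff (Bsh p a m) v ≡ β a v
      coeff-Bsh = begin
          coeff (Bsh p a m) v
        ≡⟨ coeff-concatMap _ (elems p a) v ⟩
          ΣL (elems p a) (λ α → coeff (map (λ u → (1ℚ , u)) (shuffle (Vec.map lift α) W)) v)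
        ≡⟨ ΣL-cong (elems p a) coeff-shuffle-lift ⟩
          ΣL (elems p a) (λ α → 𝟙⟨ does (X ≟ᵂ toList (Vec.map lift α)) ⟩ * E)
        ≡⟨ trans (ΣL-cong (elems p a) (λ α → *-comm _ E)) (ΣL-*ˡ (elems p a) E _) ⟩
          E * ΣL (elems p a) (λ α → 𝟙⟨ does (X ≟ᵂ toList (Vec.map lift α)) ⟩)
        ≡⟨ cong (E *_) Σ-elems-lift ⟩
          E * (𝟙⟨ uX ⟩ * 𝟙⟨ length X ≡ᵇ a ⟩)
        ≡⟨ β-from-parts ⟩
          β a v ∎
        where open ≡-Reasoning

  coeff-B : ∀ {p n} .{{_ : NonZero p}} (a : ℕ) → a ≤ n → (w : Word p n) → coeff (B p n a) w ≡ β a w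
  coeff-B zero _ w = coeff-B₀ w
  coeff-B {p} {n} (suc a) 1+a≤n w with suc a ℕ.<? n
  ... | yes a<n = transport (ℕP.m+[n∸m]≡n (ℕP.<⇒≤ a<n)) (Bsh p (suc a) (n ∸ suc a)) (Shuffled.coeff-Bsh p (suc a) (n ∸ suc a))
    where
    transport : ∀ {k} (e : k ≡ n) (X : QG p k) → (∀ v → coeff X v ≡ β (suc a) v) → coeff (subst (QG p) e X) w ≡ β (suc a) w
    transport refl X h = h w
  ... | no a≮n = begin
      coeff (map (λ α → (1ℚ , α)) (elems p n)) w
    ≡⟨ trans (coeff-elems w) (cong 𝟙⟨_⟩ (distinctPositions≡ w)) ⟩
      𝟙⟨ does (unique? (positions w)) ⟩
    ≡⟨ sym (trans (cong₂ (λ X Y → 𝟙⟨ does (unique? (positions w)) ⟩ * 𝟙⟨ does (X ≟ᴸ Y) ⟩) no-trailing no-identityTail) (*-identityʳ _)) ⟩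
      β (suc a) w ∎
    where
    open ≡-Reasoning
    1+a≡n : suc a ≡ n
    1+a≡n = ℕP.≤-antisym 1+a≤n (ℕP.≮⇒≥ a≮n)
    no-trailing : trailing (suc a) w ≡ []
    no-trailing = filterᵇ-none _ (νL w) (All.map (λ {y} b → >⇒≤ᵇ≡false (subst (proj₂ y <_) (sym 1+a≡n) (proj₂ b))) (νL-bounds w))
    no-identityTail : identityTail {p} {n} (suc a) ≡ []
    no-identityTail = cong (λ j → map colourless (range (suc a) j)) (trans (cong (_∸ suc a) (sym 1+a≡n)) (ℕP.n∸n≡0 (suc a)))

module LeftMultiplicationByB₁ where

  open Sums
  open NatEmbedding
  open Coefficients
  open Enumeration
  open Insertion
  open Characteristic using (β)
  open ShiftCount using (Σ-ψW-β)
  open BCoefficients using (coeff-B)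
  open import Data.Nat as ℕ using (ℕ; NonZero; _<_; z≤n; _≤ᵇ_)
  import Data.Nat.Properties as ℕP
  import Data.Vec as Vec
  open import Data.Product using (proj₁; proj₂)
  open import Data.Bool using (true; false; if_then_else_)
  open import Data.Rational using (ℚ; 0ℚ; 1ℚ; _+_; _*_)
  open import Data.Rational.Properties
  open import Relation.Nullary using (does)
  open import Relation.Binary.PropositionalEquality

  module _ {p n : ℕ} .{{_ : NonZero p}} .{{_ : NonZero n}} where
    β₀-ψW : ∀ c t → c < p → t < n → (u : Word p n) → β 0 (ψW c t u) ≡ 𝟙⟨ does (insertion c t ≟ʷ u) ⟩
    β₀-ψW c t c<p t<n u = trans (sym (coeff-B 0 z≤n (ψW c t u))) (trans (unit (does (idW ≟ʷ ψW c t u)))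
      (cong 𝟙⟨_⟩ (does-⇔ (mk⇔ to from) (idW ≟ʷ ψW c t u) (insertion c t ≟ʷ u))))
      where
      unit : ∀ b → (if b then 1ℚ + 0ℚ else 0ℚ) ≡ 𝟙⟨ b ⟩
      unit true = +-identityʳ 1ℚ
      unit false = refl
      to : idW ≡ ψW c t u → insertion c t ≡ u
      to e = trans (cong (Vec.map (φL c t)) e) (map-φL∘ψL c t c<p t<n u)
      from : insertion c t ≡ u → idW ≡ ψW c t u
      from e = trans (sym (map-ψL∘φL c t c<p t<n idW)) (cong (Vec.map (ψL c t)) e)

    -- The a = 0 case of the shift count says that B₁ is the sum of the insertion words.
    β₁≡Σ-insertion : (u : Word p n) → β 1 u ≡ Σ< p (λ c → Σ< n (λ t → 𝟙⟨ does (insertion c t ≟ʷ u) ⟩))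
    β₁≡Σ-insertion u = sym (begin
        Σ< p (λ c → Σ< n (λ t → 𝟙⟨ does (insertion c t ≟ʷ u) ⟩))
      ≡⟨ Σ<-cong p (λ c c<p → Σ<-cong n (λ t t<n → sym (β₀-ψW c t c<p t<n u))) ⟩
        Σ< p (λ c → Σ< n (λ t → β 0 (ψW c t u)))
      ≡⟨ Σ-ψW-β 0 z≤n u ⟩
        ι (p ℕ.* 0) * β 0 u + 𝟙⟨ 1 ≤ᵇ n ⟩ * β 1 u
      ≡⟨ cong₂ (λ k b → ι k * β 0 u + 𝟙⟨ b ⟩ * β 1 u) (ℕP.*-zeroʳ p) 1≤ᵇn ⟩
        0ℚ * β 0 u + 1ℚ * β 1 u
      ≡⟨ trans (cong₂ _+_ (*-zeroˡ (β 0 u)) (*-identityˡ (β 1 u))) (+-identityˡ _) ⟩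
        β 1 u ∎)
      where
      open ≡-Reasoning
      1≤ᵇn : (1 ℕ.≤ᵇ n) ≡ true
      1≤ᵇn = ListFacts.≤⇒≤ᵇ≡true (ℕ.>-nonZero⁻¹ n)

    coeff-B₁-* : (y : QG p n) (w : Word p n) → coeff (B p n 1 *ᴬ y) w ≡ Σ< p (λ c → Σ< n (λ t → coeff y (ψW c t w)))
    coeff-B₁-* y w = begin
        coeff (B p n 1 *ᴬ y) w
      ≡⟨ coeff-*ᴬ (B p n 1) y w ⟩
        ΣL (B p n 1) (λ e → proj₁ e * H (proj₂ e))
      ≡⟨ ΣL-support (B p n 1) H ⟩
        ΣL (allWords p n) (λ u → coeff (B p n 1) u * H u)
      ≡⟨ ΣL-cong (allWords p n) (λ u → cong (_* H u) (trans (coeff-B 1 (ℕ.>-nonZero⁻¹ n) u) (β₁≡Σ-insertion u))) ⟩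
        ΣL (allWords p n) (λ u → Σ< p (λ c → Σ< n (λ t → 𝟙⟨ does (insertion c t ≟ʷ u) ⟩)) * H u)
      ≡⟨ ΣL-cong (allWords p n) (λ u → trans (sym (Σ<-*ʳ p _ (H u))) (Σ<-cong p (λ c _ → sym (Σ<-*ʳ n _ (H u))))) ⟩
        ΣL (allWords p n) (λ u → Σ< p (λ c → Σ< n (λ t → 𝟙⟨ does (insertion c t ≟ʷ u) ⟩ * H u)))
      ≡⟨ trans (ΣL-Σ< (allWords p n) p _) (Σ<-cong p (λ c _ → ΣL-Σ< (allWords p n) n _)) ⟩
        Σ< p (λ c → Σ< n (λ t → ΣL (allWords p n) (λ u → 𝟙⟨ does (insertion c t ≟ʷ u) ⟩ * H u)))
      ≡⟨ Σ<-cong p (λ c c<p → Σ<-cong n (λ t t<n → trans (ΣL-allWords-δ (insertion c t) H) (coeff-leftMul-insertion c t c<p t<n y w))) ⟩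
        Σ< p (λ c → Σ< n (λ t → coeff y (ψW c t w))) ∎
      where
      open ≡-Reasoning
      H : Word p n → ℚ
      H u = coeff (leftMul u y) w

module EigenCoefficients (p : ℕ) .{{p≢0 : NonZero p}} where

  open Sums
  open NatEmbedding
  open import Data.Nat as ℕ using (ℕ; zero; suc; _∸_; _!; _^_; _≤_)
  import Data.Nat.Properties as ℕP
  import Data.Nat.Solver as ℕS
  import Data.Rational.Solver as ℚS
  open import Data.Integer as ℤ using (ℤ; -1ℤ)
  import Data.Integer.Properties as ℤP
  open import Data.Rational as ℚ using (ℚ; 0ℚ; _+_; _*_; -_)
  open import Data.Rational.Properties
  open import Relation.Binary.PropositionalEquality

  private
    D : ℕ → ℕ → ℕ → ℕ
    D i a k = i ! ℕ.* (p ^ a ℕ.* k !)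

    D≢0 : ∀ i a k → NonZero (D i a k)
    D≢0 i a k = ℕP.m*n≢0 (i !) _ {{i ℕP.!≢0}} {{ℕP.m*n≢0 (p ^ a) (k !) {{ℕP.m^n≢0 p a}} {{k ℕP.!≢0}}}}

    p*D≢0 : ∀ i a k → NonZero (p ℕ.* D i a k)
    p*D≢0 i a k = ℕP.m*n≢0 p (D i a k) {{p≢0}} {{D≢0 i a k}}

    m*p*D≢0 : ∀ m i a k → NonZero (suc m ℕ.* (p ℕ.* D i a k))
    m*p*D≢0 m i a k = ℕP.m*n≢0 (suc m) (p ℕ.* D i a k) {{_}} {{p*D≢0 i a k}}

    coefE≡ : ∀ i a k → a ∸ i ≡ k → coefE p i a ≡ ((-1ℤ ℤ.^ k) ℚ./ D i a k) {{D≢0 i a k}}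
    coefE≡ i a .(a ∸ i) refl = refl

    /-*-ι-*-ι : ∀ x m i a k → ((x ℚ./ (suc m ℕ.* (p ℕ.* D i a k))) {{m*p*D≢0 m i a k}} * ι (suc m)) * ι p ≡ (x ℚ./ D i a k) {{D≢0 i a k}}
    /-*-ι-*-ι x m i a k = trans (cong (_* ι p) (/-*-ι x (suc m) (p ℕ.* D i a k) {{p*D≢0 i a k}} {{m*p*D≢0 m i a k}}))
                                (/-*-ι x p (D i a k) {{D≢0 i a k}} {{p*D≢0 i a k}})

  coefE-suc-suc : ∀ i a → coefE p (suc i) (suc a) * ι (suc i) * ι p ≡ coefE p i a
  coefE-suc-suc i a = trans (cong (λ z → z * ι (suc i) * ι p) (/-denominator s {D (suc i) (suc a) k} {{D≢0 (suc i) (suc a) k}} {{m*p*D≢0 i i a k}} (reassoc (suc i) (i !) (p ^ a) (k !))))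
                            (/-*-ι-*-ι s i i a k)
    where
    k : ℕ
    k = a ∸ i
    s : ℤ
    s = -1ℤ ℤ.^ k
    reassoc : ∀ I F Q K → (I ℕ.* F) ℕ.* ((p ℕ.* Q) ℕ.* K) ≡ I ℕ.* (p ℕ.* (F ℕ.* (Q ℕ.* K)))
    reassoc I F Q K = solve 5 (λ P I F Q K → (I :* F) :* ((P :* Q) :* K) := I :* (P :* (F :* (Q :* K)))) refl p I F Q K
      where open ℕS.+-*-Solver

  coefE-raise : ∀ i a → i ≤ a → coefE p i (suc a) * ι (suc (a ∸ i)) * ι p ≡ - coefE p i a
  coefE-raise i a i≤a = begin
      coefE p i (suc a) * ι (suc k) * ι p
    ≡⟨ cong (λ z → z * ι (suc k) * ι p) (trans (coefE≡ i (suc a) (suc k) (ℕP.+-∸-assoc 1 i≤a))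
                                                 (/-denominator (-1ℤ ℤ.^ suc k) {{D≢0 i (suc a) (suc k)}} {{m*p*D≢0 k i a k}} (reassoc (i !) (p ^ a) (suc k) (k !)))) ⟩
      ((-1ℤ ℤ.^ suc k) ℚ./ (suc k ℕ.* (p ℕ.* D i a k))) {{m*p*D≢0 k i a k}} * ι (suc k) * ι p
    ≡⟨ /-*-ι-*-ι (-1ℤ ℤ.^ suc k) k i a k ⟩
      ((-1ℤ ℤ.* s) ℚ./ D i a k) {{D≢0 i a k}}
    ≡⟨ cong (λ x → (x ℚ./ D i a k) {{D≢0 i a k}}) (ℤP.-1*i≡-i s) ⟩
      ((ℤ.- s) ℚ./ D i a k) {{D≢0 i a k}}
    ≡⟨ sym (-‿/ s (D i a k) {{D≢0 i a k}}) ⟩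
      - coefE p i a ∎
    where
    open ≡-Reasoning
    k : ℕ
    k = a ∸ i
    s : ℤ
    s = -1ℤ ℤ.^ k
    reassoc : ∀ F Q K K! → F ℕ.* ((p ℕ.* Q) ℕ.* (K ℕ.* K!)) ≡ K ℕ.* (p ℕ.* (F ℕ.* (Q ℕ.* K!)))
    reassoc F Q K K! = solve 5 (λ P F Q K K! → F :* ((P :* Q) :* (K :* K!)) := K :* (P :* (F :* (Q :* K!)))) refl p F Q K K!
      where open ℕS.+-*-Solver

  private
    c : ℕ → ℕ → ℚ
    c i a = coefE p i a

    weight-split : ∀ a → ι (suc a) * Σ< (suc (suc a)) (λ i → c i (suc a))
      ≡ Σ< (suc a) (λ i → ι (suc i) * c (suc i) (suc a)) + Σ< (suc a) (λ i → ι (suc a ∸ i) * c i (suc a))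
    weight-split a = begin
        ι (suc a) * Σ< (suc (suc a)) (λ i → c i (suc a))
      ≡⟨ sym (Σ<-*ˡ (suc (suc a)) (ι (suc a)) (λ i → c i (suc a))) ⟩
        Σ< (suc (suc a)) (λ i → ι (suc a) * c i (suc a))
      ≡⟨ Σ<-cong (suc (suc a)) (λ i i<2+a → trans (cong (λ z → ι z * c i (suc a)) (sym (ℕP.m+[n∸m]≡n (ℕP.≤-pred i<2+a))))
            (trans (cong (_* c i (suc a)) (ι-+ i (suc a ∸ i))) (*-distribʳ-+ (c i (suc a)) (ι i) (ι (suc a ∸ i))))) ⟩
        Σ< (suc (suc a)) (λ i → ι i * c i (suc a) + f i)
      ≡⟨ Σ<-+ (suc (suc a)) (λ i → ι i * c i (suc a)) f ⟩
        (0ℚ * c 0 (suc a) + L) + Σ< (suc (suc a)) f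
      ≡⟨ cong₂ _+_ (trans (cong (_+ L) (*-zeroˡ (c 0 (suc a)))) (+-identityˡ L)) (Σ<-last (suc a) f) ⟩
        L + (R + ι (suc a ∸ suc a) * c (suc a) (suc a))
      ≡⟨ cong (λ z → L + (R + ι z * c (suc a) (suc a))) (ℕP.n∸n≡0 (suc a)) ⟩
        L + (R + 0ℚ * c (suc a) (suc a))
      ≡⟨ cong (L +_) (trans (cong (R +_) (*-zeroˡ (c (suc a) (suc a)))) (+-identityʳ R)) ⟩
        L + R ∎
      where
      open ≡-Reasoning
      f : ℕ → ℚ
      f i = ι (suc a ∸ i) * c i (suc a)
      L R : ℚ
      L = Σ< (suc a) (λ i → ι (suc i) * c (suc i) (suc a))
      R = Σ< (suc a) f

  -- The alternating binomial identity Σ_{i ≤ a+1} (-1)^{a+1-i} / (i! (a+1-i)!) = 0, in the form: weighting the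
  -- summands by p (a+1) = p i + p (a+1-i) turns both halves into the coefficients of index a, with opposite signs.
  Σ-coefE : ∀ a → Σ< (suc (suc a)) (λ i → c i (suc a)) ≡ 0ℚ
  Σ-coefE a = ι-suc*≡0⇒≡0 (ℕ.pred (p ℕ.* suc a)) S (trans (cong (λ z → ι z * S) (ℕP.suc-pred (p ℕ.* suc a) {{ℕP.m*n≢0 p (suc a)}})) weighted)
    where
    open ≡-Reasoning
    S : ℚ
    S = Σ< (suc (suc a)) (λ i → c i (suc a))
    swap : ∀ P X C → P * (X * C) ≡ C * X * P
    swap P X C = trans (*-comm P (X * C)) (cong (_* P) (*-comm X C))
    weighted : ι (p ℕ.* suc a) * S ≡ 0ℚ
    weighted = begin
        ι (p ℕ.* suc a) * S
      ≡⟨ trans (cong (_* S) (ι-* p (suc a))) (*-assoc (ι p) (ι (suc a)) S) ⟩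
        ι p * (ι (suc a) * S)
      ≡⟨ trans (cong (ι p *_) (weight-split a)) (trans (*-distribˡ-+ (ι p) _ _)
           (cong₂ _+_ (sym (Σ<-*ˡ (suc a) (ι p) (λ i → ι (suc i) * c (suc i) (suc a)))) (sym (Σ<-*ˡ (suc a) (ι p) (λ i → ι (suc a ∸ i) * c i (suc a)))))) ⟩
        Σ< (suc a) (λ i → ι p * (ι (suc i) * c (suc i) (suc a))) + Σ< (suc a) (λ i → ι p * (ι (suc a ∸ i) * c i (suc a)))
      ≡⟨ cong₂ _+_ (Σ<-cong (suc a) (λ i _ → trans (swap (ι p) (ι (suc i)) (c (suc i) (suc a))) (coefE-suc-suc i a)))
                    (Σ<-cong (suc a) (λ i i<1+a → trans (swap (ι p) (ι (suc a ∸ i)) (c i (suc a)))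
                       (trans (cong (λ z → c i (suc a) * ι z * ι p) (ℕP.+-∸-assoc 1 (ℕP.≤-pred i<1+a))) (coefE-raise i a (ℕP.≤-pred i<1+a))))) ⟩
        Σ< (suc a) (λ i → c i a) + Σ< (suc a) (λ i → - c i a)
      ≡⟨ sym (Σ<-+ (suc a) (λ i → c i a) (λ i → - c i a)) ⟩
        Σ< (suc a) (λ i → c i a + - c i a)
      ≡⟨ trans (Σ<-cong (suc a) (λ i _ → +-inverseʳ (c i a))) (Σ<-zero (suc a)) ⟩
        0ℚ ∎

  -- For f b = coeff (B p n b) w, E n f i is the coefficient of e_i at w.
  E : ℕ → (ℕ → ℚ) → ℕ → ℚ
  E N f i = Σ< (suc (N ∸ i)) (λ j → c i (i ℕ.+ j) * f (i ℕ.+ j))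

  private
    E-suc : ∀ N f i → i ≤ N → E (suc N) f i ≡ E N f i + c i (suc N) * f (suc N)
    E-suc N f i i≤N = begin
        Σ< (suc (suc N ∸ i)) g
      ≡⟨ cong (λ k → Σ< (suc k) g) (ℕP.+-∸-assoc 1 i≤N) ⟩
        Σ< (suc (suc (N ∸ i))) g
      ≡⟨ Σ<-last (suc (N ∸ i)) g ⟩
        E N f i + g (suc (N ∸ i))
      ≡⟨ cong (λ k → E N f i + c i k * f k) (trans (ℕP.+-suc i (N ∸ i)) (cong suc (ℕP.m+[n∸m]≡n i≤N))) ⟩
        E N f i + c i (suc N) * f (suc N) ∎
      where
      open ≡-Reasoning
      g : ℕ → ℚ
      g j = c i (i ℕ.+ j) * f (i ℕ.+ j)

    E-top : ∀ N f → E N f N ≡ c N N * f N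
    E-top N f = trans (cong (λ k → Σ< (suc k) (λ j → c N (N ℕ.+ j) * f (N ℕ.+ j))) (ℕP.n∸n≡0 N))
      (trans (+-identityʳ _) (cong (λ k → c N k * f k) (ℕP.+-identityʳ N)))

  -- Σ_i e_i = B₀: the e-coefficients of f sum to f 0, by Σ-coefE in every degree b > 0.
  Σ-E : ∀ N (f : ℕ → ℚ) → Σ< (suc N) (E N f) ≡ f 0
  Σ-E zero f = trans (+-identityʳ _) (trans (+-identityʳ _) (*-identityˡ (f 0)))
  Σ-E (suc N) f = begin
      Σ< (suc (suc N)) (E (suc N) f)
    ≡⟨ Σ<-last (suc N) (E (suc N) f) ⟩
      Σ< (suc N) (E (suc N) f) + E (suc N) f (suc N)
    ≡⟨ cong₂ _+_ (Σ<-cong (suc N) (λ i i<1+N → E-suc N f i (ℕP.≤-pred i<1+N))) (E-top (suc N) f) ⟩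
      Σ< (suc N) (λ i → E N f i + c i (suc N) * F) + c (suc N) (suc N) * F
    ≡⟨ cong (_+ c (suc N) (suc N) * F) (Σ<-+ (suc N) (E N f) (λ i → c i (suc N) * F)) ⟩
      Σ< (suc N) (E N f) + Σ< (suc N) (λ i → c i (suc N) * F) + c (suc N) (suc N) * F
    ≡⟨ trans (+-assoc (Σ< (suc N) (E N f)) _ _) (cong (Σ< (suc N) (E N f) +_) (sym (Σ<-last (suc N) (λ i → c i (suc N) * F)))) ⟩
      Σ< (suc N) (E N f) + Σ< (suc (suc N)) (λ i → c i (suc N) * F)
    ≡⟨ cong₂ _+_ (Σ-E N f) (trans (Σ<-*ʳ (suc (suc N)) (λ i → c i (suc N)) F) (trans (cong (_* F) (Σ-coefE N)) (*-zeroˡ F))) ⟩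
      f 0 + 0ℚ
    ≡⟨ +-identityʳ (f 0) ⟩
      f 0 ∎
    where
    open ≡-Reasoning
    F : ℚ
    F = f (suc N)

  private
    Σ-telescope : (κ x : ℕ → ℚ) (P P₀ : ℚ) → (∀ j → κ (suc j) * (P * ι (suc j)) ≡ - κ j) → ∀ M →
      Σ< (suc M) (λ j → κ j * ((P₀ + P * ι j) * x j + x (suc j))) ≡ P₀ * Σ< (suc M) (λ j → κ j * x j) + κ M * x (suc M)
    Σ-telescope κ x P P₀ h zero = solve 5 (λ C P P₀ X₀ X₁ → C :* ((P₀ :+ P :* con 0ℚ) :* X₀ :+ X₁) :+ con 0ℚ := P₀ :* (C :* X₀ :+ con 0ℚ) :+ C :* X₁)
      refl (κ 0) P P₀ (x 0) (x 1)
      where open ℚS.+-*-Solver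
    Σ-telescope κ x P P₀ h (suc M) = begin
        Σ< (suc (suc M)) g
      ≡⟨ trans (Σ<-last (suc M) g) (cong (_+ g (suc M)) (Σ-telescope κ x P P₀ h M)) ⟩
        P₀ * S + κ M * x (suc M) + g (suc M)
      ≡⟨ cong (λ z → P₀ * S + z * x (suc M) + g (suc M)) (trans (solve 1 (λ A → A := :- (:- A)) refl (κ M)) (cong -_ (sym (h M)))) ⟩
        P₀ * S + - (κ (suc M) * (P * ι (suc M))) * x (suc M) + g (suc M)
      ≡⟨ solve 7 (λ P₀ S A P J X₁ X₂ → P₀ :* S :+ (:- (A :* (P :* J))) :* X₁ :+ A :* ((P₀ :+ P :* J) :* X₁ :+ X₂)
                    := P₀ :* (S :+ A :* X₁) :+ A :* X₂) refl P₀ S (κ (suc M)) P (ι (suc M)) (x (suc M)) (x (suc (suc M))) ⟩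
        P₀ * (S + κ (suc M) * x (suc M)) + κ (suc M) * x (suc (suc M))
      ≡⟨ cong (λ z → P₀ * z + κ (suc M) * x (suc (suc M))) (sym (Σ<-last (suc M) (λ j → κ j * x j))) ⟩
        P₀ * Σ< (suc (suc M)) (λ j → κ j * x j) + κ (suc M) * x (suc (suc M)) ∎
      where
      open ≡-Reasoning
      open ℚS.+-*-Solver
      g : ℕ → ℚ
      g j = κ j * ((P₀ + P * ι j) * x j + x (suc j))
      S : ℚ
      S = Σ< (suc M) (λ j → κ j * x j)

    ι-p*[i+j] : ∀ i j → ι (p ℕ.* (i ℕ.+ j)) ≡ ι (p ℕ.* i) + ι p * ι j
    ι-p*[i+j] i j = trans (cong ι (ℕP.*-distribˡ-+ p i j)) (trans (ι-+ (p ℕ.* i) (p ℕ.* j)) (cong (ι (p ℕ.* i) +_) (ι-* p j)))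

    coefE-step : ∀ i j → c i (i ℕ.+ suc j) * (ι p * ι (suc j)) ≡ - c i (i ℕ.+ j)
    coefE-step i j = begin
        c i (i ℕ.+ suc j) * (ι p * ι (suc j))
      ≡⟨ cong (λ z → c i z * (ι p * ι (suc j))) (ℕP.+-suc i j) ⟩
        C * (ι p * ι (suc j))
      ≡⟨ trans (cong (C *_) (*-comm (ι p) (ι (suc j)))) (sym (*-assoc C (ι (suc j)) (ι p))) ⟩
        C * ι (suc j) * ι p
      ≡⟨ cong (λ z → C * ι (suc z) * ι p) (sym (ℕP.m+n∸m≡n i j)) ⟩
        C * ι (suc (i ℕ.+ j ∸ i)) * ι p
      ≡⟨ coefE-raise i (i ℕ.+ j) (ℕP.m≤m+n i j) ⟩
        - c i (i ℕ.+ j) ∎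
      where
      open ≡-Reasoning
      C : ℚ
      C = c i (suc (i ℕ.+ j))

  -- B₁ e_i = p i e_i: the coefficients of B₁ B_b = p b B_b + B_{b+1} telescope.
  E-eigen : ∀ n i → i ≤ n → (f : ℕ → ℚ) →
    E n (λ b → ι (p ℕ.* b) * f b + 𝟙⟨ suc b ℕ.≤ᵇ n ⟩ * f (suc b)) i ≡ ι (p ℕ.* i) * E n f i
  E-eigen n i i≤n f = begin
      Σ< (suc M) (λ j → κ j * (ι (p ℕ.* (i ℕ.+ j)) * f (i ℕ.+ j) + 𝟙⟨ suc (i ℕ.+ j) ℕ.≤ᵇ n ⟩ * f (suc (i ℕ.+ j))))
    ≡⟨ Σ<-cong (suc M) (λ j j<1+M → cong (κ j *_) (cong₂ _+_ (cong₂ _*_ (ι-p*[i+j] i j) (sym (x≡ j (ℕP.≤-pred j<1+M))))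
          (cong (λ z → 𝟙⟨ z ℕ.≤ᵇ n ⟩ * f z) (sym (ℕP.+-suc i j))))) ⟩
      Σ< (suc M) (λ j → κ j * ((ι (p ℕ.* i) + ι p * ι j) * x j + x (suc j)))
    ≡⟨ Σ-telescope κ x (ι p) (ι (p ℕ.* i)) (coefE-step i) M ⟩
      ι (p ℕ.* i) * Σ< (suc M) (λ j → κ j * x j) + κ M * x (suc M)
    ≡⟨ cong (ι (p ℕ.* i) * Σ< (suc M) (λ j → κ j * x j) +_) (trans (cong (κ M *_) x-beyond) (*-zeroʳ (κ M))) ⟩
      ι (p ℕ.* i) * Σ< (suc M) (λ j → κ j * x j) + 0ℚ
    ≡⟨ trans (+-identityʳ _) (cong (ι (p ℕ.* i) *_) (Σ<-cong (suc M) (λ j j<1+M → cong (κ j *_) (x≡ j (ℕP.≤-pred j<1+M))))) ⟩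
      ι (p ℕ.* i) * E n f i ∎
    where
    open ≡-Reasoning
    M : ℕ
    M = n ∸ i
    κ : ℕ → ℚ
    κ j = c i (i ℕ.+ j)
    x : ℕ → ℚ
    x j = 𝟙⟨ i ℕ.+ j ℕ.≤ᵇ n ⟩ * f (i ℕ.+ j)
    x≡ : ∀ j → j ≤ M → x j ≡ f (i ℕ.+ j)
    x≡ j j≤M = trans (cong (λ b → 𝟙⟨ b ⟩ * f (i ℕ.+ j)) (ListFacts.≤⇒≤ᵇ≡true (ℕP.≤-trans (ℕP.+-monoʳ-≤ i j≤M) (ℕP.≤-reflexive (ℕP.m+[n∸m]≡n i≤n)))))
      (*-identityˡ (f (i ℕ.+ j)))
    x-beyond : x (suc M) ≡ 0ℚ
    x-beyond = trans (cong (λ b → 𝟙⟨ b ⟩ * f (i ℕ.+ suc M))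
        (ListFacts.>⇒≤ᵇ≡false (ℕP.≤-reflexive (sym (trans (ℕP.+-suc i M) (cong suc (ℕP.m+[n∸m]≡n i≤n)))))))
      (*-zeroˡ (f (i ℕ.+ suc M)))

module Spectral (p n : ℕ) .{{_ : NonZero p}} .{{_ : NonZero n}} where

  open Sums
  open NatEmbedding
  open Coefficients
  open Characteristic using (β)
  open ShiftCount using (Σ-ψW-β)
  open BCoefficients using (coeff-B)
  open LeftMultiplicationByB₁ using (coeff-B₁-*)
  open EigenCoefficients p
  open import Data.Nat as ℕ using (ℕ; zero; suc; _∸_; _^_; _≤_; z≤n; _≤ᵇ_)
  import Data.Nat.Properties as ℕP
  open import Data.List using (upTo)
  open import Data.Rational using (ℚ; _+_; _*_)
  open import Data.Rational.Properties
  open import Relation.Binary.PropositionalEquality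

  private
    index-bound : ∀ i j → i ≤ n → j ≤ n ∸ i → i ℕ.+ j ≤ n
    index-bound i j i≤n j≤n∸i = ℕP.≤-trans (ℕP.+-monoʳ-≤ i j≤n∸i) (ℕP.≤-reflexive (ℕP.m+[n∸m]≡n i≤n))

  Σe : ℕ → (ℕ → ℚ) → ℚ
  Σe k f = Σ< (suc n) (λ i → ι ((p ℕ.* i) ^ k) * E n f i)

  Σe-cong : ∀ k (f g : ℕ → ℚ) → (∀ b → b ≤ n → f b ≡ g b) → Σe k f ≡ Σe k g
  Σe-cong k f g h = Σ<-cong (suc n) (λ i i<1+n → cong (ι ((p ℕ.* i) ^ k) *_)
    (Σ<-cong (suc (n ∸ i)) (λ j j<1+n∸i → cong (coefE p i (i ℕ.+ j) *_) (h (i ℕ.+ j) (index-bound i j (ℕP.≤-pred i<1+n) (ℕP.≤-pred j<1+n∸i))))))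

  Σe-linear : ∀ k (h : ℕ → ℕ → ℕ → ℚ) → Σ< p (λ c → Σ< n (λ t → Σe k (h c t))) ≡ Σe k (λ b → Σ< p (λ c → Σ< n (λ t → h c t b)))
  Σe-linear k h = trans (Σ<²-Σ<-*ˡ p n (suc n) (λ i → ι ((p ℕ.* i) ^ k)) (λ c t i → E n (h c t) i))
    (Σ<-cong (suc n) (λ i _ → cong (ι ((p ℕ.* i) ^ k) *_)
      (Σ<²-Σ<-*ˡ p n (suc (n ∸ i)) (λ j → coefE p i (i ℕ.+ j)) (λ c t j → h c t (i ℕ.+ j)))))

  Σe-shift : ∀ k (f : ℕ → ℚ) → Σe k (λ b → ι (p ℕ.* b) * f b + 𝟙⟨ suc b ≤ᵇ n ⟩ * f (suc b)) ≡ Σe (suc k) f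
  Σe-shift k f = Σ<-cong (suc n) (λ i i<1+n → begin
      ι ((p ℕ.* i) ^ k) * E n (λ b → ι (p ℕ.* b) * f b + 𝟙⟨ suc b ≤ᵇ n ⟩ * f (suc b)) i
    ≡⟨ cong (ι ((p ℕ.* i) ^ k) *_) (E-eigen n i (ℕP.≤-pred i<1+n) f) ⟩
      ι ((p ℕ.* i) ^ k) * (ι (p ℕ.* i) * E n f i)
    ≡⟨ sym (*-assoc (ι ((p ℕ.* i) ^ k)) (ι (p ℕ.* i)) (E n f i)) ⟩
      ι ((p ℕ.* i) ^ k) * ι (p ℕ.* i) * E n f i
    ≡⟨ cong (_* E n f i) (trans (*-comm (ι ((p ℕ.* i) ^ k)) (ι (p ℕ.* i))) (sym (ι-* (p ℕ.* i) ((p ℕ.* i) ^ k)))) ⟩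
      ι ((p ℕ.* i) ^ suc k) * E n f i ∎)
    where open ≡-Reasoning

  coeff-B₁^ : ∀ k (w : Word p n) → coeff (B p n 1 ^ᴬ k) w ≡ Σe k (λ b → β b w)
  coeff-B₁^ zero w = trans (coeff-B 0 z≤n w) (sym (trans (Σ<-cong (suc n) (λ i _ → *-identityˡ (E n (λ b → β b w) i))) (Σ-E n (λ b → β b w))))
  coeff-B₁^ (suc k) w = begin
      coeff (B p n 1 *ᴬ (B p n 1 ^ᴬ k)) w
    ≡⟨ coeff-B₁-* (B p n 1 ^ᴬ k) w ⟩
      Σ< p (λ c → Σ< n (λ t → coeff (B p n 1 ^ᴬ k) (ψW c t w)))
    ≡⟨ Σ<-cong p (λ c _ → Σ<-cong n (λ t _ → coeff-B₁^ k (ψW c t w))) ⟩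
      Σ< p (λ c → Σ< n (λ t → Σe k (λ b → β b (ψW c t w))))
    ≡⟨ Σe-linear k (λ c t b → β b (ψW c t w)) ⟩
      Σe k (λ b → Σ< p (λ c → Σ< n (λ t → β b (ψW c t w))))
    ≡⟨ Σe-cong k _ _ (λ b b≤n → Σ-ψW-β b b≤n w) ⟩
      Σe k (λ b → ι (p ℕ.* b) * β b w + 𝟙⟨ suc b ≤ᵇ n ⟩ * β (suc b) w)
    ≡⟨ Σe-shift k (λ b → β b w) ⟩
      Σe (suc k) (λ b → β b w) ∎
    where
    open ≡-Reasoning
    open Insertion using (ψW)

  coeff-rhs : ∀ k (w : Word p n) → coeff (rhs p n k) w ≡ Σe k (λ b → β b w)
  coeff-rhs k w = begin
      coeff (rhs p n k) w
    ≡⟨ trans (coeff-concatMap (λ i → ι ((p ℕ.* i) ^ k) • e p n i) (upTo (suc n)) w) (ΣL-upTo (suc n) (λ i → coeff (ι ((p ℕ.* i) ^ k) • e p n i) w)) ⟩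
      Σ< (suc n) (λ i → coeff (ι ((p ℕ.* i) ^ k) • e p n i) w)
    ≡⟨ Σ<-cong (suc n) (λ i i<1+n → trans (coeff-• (ι ((p ℕ.* i) ^ k)) (e p n i) w) (cong (ι ((p ℕ.* i) ^ k) *_) (coeff-e i (ℕP.≤-pred i<1+n)))) ⟩
      Σe k (λ b → β b w) ∎
    where
    open ≡-Reasoning
    coeff-e : ∀ i → i ≤ n → coeff (e p n i) w ≡ E n (λ b → β b w) i
    coeff-e i i≤n = trans (coeff-concatMap term (upTo (suc (n ∸ i))) w) (trans (ΣL-upTo (suc (n ∸ i)) (λ j → coeff (term j) w))
      (Σ<-cong (suc (n ∸ i)) (λ j j<1+n∸i → trans (coeff-• (coefE p i (i ℕ.+ j)) (B p n (i ℕ.+ j)) w)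
        (cong (coefE p i (i ℕ.+ j) *_) (coeff-B (i ℕ.+ j) (index-bound i j i≤n (ℕP.≤-pred j<1+n∸i)) w)))))
      where
      term : ℕ → QG p n
      term j = coefE p i (i ℕ.+ j) • B p n (i ℕ.+ j)

theorem4 : (n p : ℕ) .{{_ : NonZero p}} → 1 ≤ n → (k : ℕ) →
    (B p n 1 ^ᴬ k) ≈ᴬ rhs p n k
theorem4 zero p () k
theorem4 (suc n) p _ k w = trans (coeff-B₁^ k w) (sym (coeff-rhs k w))
  where open Spectral p (suc n)
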